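{- Let $n>2$. If $n$ is odd, there exists a symmetric matrix $Y\in O_n(\mathbb{Q})$ with zero-pattern $\Lambda_n$. If $n$ is even, there exists a symmetric matrix $Z\in O_n(\mathbb{Q})$ with zero-pattern $\Lambda_n^{\#}$.
   Context: $O_n(\mathbb{Q})$ is the set of $n\times n$ real orthogonal matrices with rational entries; the zero-pattern of a matrix is the $(0,1)$-matrix with $1$ exactly where the matrix is nonzero. Definition of $\Lambda_n$: let $S$ be the $n\times n$ $(0,1)$-matrix (the support of a "special zigzag" matrix) whose row $1$ has ones exactly in columns $1,2$, and, for $2\le i\le n$ with $k=\lfloor i/2\rfloor$, whose row $i$ has ones exactly in the columns $j$ with $2k-1\le j\le \min(2k+2,n)$. Then $\Lambda_n$ is obtained from $S$ by reversing the order of rows: $(\Lambda_n)_{i,j}=S_{n+1-i,j}$. (For odd $n$ it is symmetric.) Definition of $\Lambda_n^{\#}$ for even $n=2m\ge4$: index rows and columns by offsets $r,c\in\{ -(m-1),\dots,m\}$ (offset $r$ corresponds to index $r+m$). The entry in row $r$, column $c$ is $1$ exactly when: for $r\in\{ -1,0\}$, $-1\le c\le 3$; for $r=1$, $-1\le c\le 1$; for $r\in\{2k,2k+1\}$ with $k\ge1$, $-(2k+1)\le c\le -(2k-2)$; for $r\in\{ -2k-1,-2k\}$ with $k\ge1$, $2k\le c\le 2k+3$; all other entries are $0$. For example $\Lambda_4^{\#}=\begin{bmatrix}1&1&1&1\\1&1&1&1\\1&1&1&0\\1&1&0&0\end{bmatrix}$, $\Lambda_6^{\#}=\begin{bmatrix}0&0&0&0&1&1\\0&1&1&1&1&1\\0&1&1&1&1&1\\0&1&1&1&0&0\\1&1&1&0&0&0\\1&1&1&0&0&0\end{bmatrix}$.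 $\Lambda_n^{\#}$ is symmetric with $4n-3$ ones. -}

module Defs where

open import Data.Bool using (Bool; true; false; _∧_; if_then_else_)
open import Data.Nat as ℕ using (ℕ; zero; suc; _∸_; _/_)
open import Data.Integer as ℤ using (ℤ; +_; -[1+_]; -_)
open import Data.Fin using (Fin; zero; suc; toℕ)
open import Data.Rational as ℚ using (ℚ; 0ℚ; 1ℚ)
open import Relation.Binary.PropositionalEquality using (_≡_; _≢_)
open import Function.Bundles using (_⇔_)
open import Data.Product using (_×_)

Matrix : ℕ → Set
Matrix n = Fin n → Fin n → ℚ

Pattern : ℕ → Set
Pattern n = Fin n → Fin n → Bool

sumFin : (n : ℕ) → (Fin n → ℚ) → ℚ
sumFin zero    f = 0ℚ
sumFin (suc n) f = f zero ℚ.+ sumFin n (λ i → f (suc i))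

transpose : ∀ {n} → Matrix n → Matrix n
transpose A i j = A j i

_⊗_ : ∀ {n} → Matrix n → Matrix n → Matrix n
_⊗_ {n} A B i j = sumFin n (λ k → A i k ℚ.* B k j)

δ : ∀ {n} → Fin n → Fin n → ℚ
δ zero    zero    = 1ℚ
δ zero    (suc j) = 0ℚ
δ (suc i) zero    = 0ℚ
δ (suc i) (suc j) = δ i j

identity : ∀ {n} → Matrix n
identity = δ

IsSymmetric : ∀ {n} → Matrix n → Set
IsSymmetric A = ∀ i j → A i j ≡ A j i

IsOrthogonal : ∀ {n} → Matrix n → Set
IsOrthogonal A = (∀ i j → (A ⊗ transpose A) i j ≡ identity i j)
               × (∀ i j → (transpose A ⊗ A) i j ≡ identity i j)

HasZeroPattern : ∀ {n} → Matrix n → Pattern n → Set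
HasZeroPattern A P = ∀ i j → (A i j ≢ 0ℚ) ⇔ (P i j ≡ true)

-- Support S of the special zigzag matrix, 1-based indices (s, c) in an n×n matrix.
-- row 1: columns 1,2; row s ≥ 2, k = ⌊s/2⌋: columns 2k-1 ≤ c ≤ min(2k+2, n).
zigzagS : ℕ → ℕ → ℕ → Bool
zigzagS n 1 c = (1 ℕ.≤ᵇ c) ∧ (c ℕ.≤ᵇ 2)
zigzagS n s c =
  ((2 ℕ.* (s / 2)) ∸ 1 ℕ.≤ᵇ c) ∧ ((c ℕ.≤ᵇ 2 ℕ.* (s / 2) ℕ.+ 2) ∧ (c ℕ.≤ᵇ n))

-- Λ_n : rows of S reversed.  0-based (i, j) ↦ 1-based (i+1, j+1);
-- row i+1 of Λ_n is row n+1-(i+1) = n - i of S.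
Λ : (n : ℕ) → Pattern n
Λ n i j = zigzagS n (n ∸ toℕ i) (suc (toℕ j))

-- Λ^#_{2m}, via offsets r, c ∈ {-(m-1),…,m}; offset r is 1-based index r+m,
-- i.e. 0-based index i gives r = (i+1) - m.
offset : (m : ℕ) → ℕ → ℤ
offset m i = + (suc i) ℤ.- + m

inRange : ℤ → ℤ → ℤ → Bool
inRange a b c = (a ℤ.≤ᵇ c) ∧ (c ℤ.≤ᵇ b)

sharpEntry : ℤ → ℤ → Bool
sharpEntry (+ 0) c = inRange (ℤ.- + 1) (+ 3) c
sharpEntry (+ 1) c = inRange (ℤ.- + 1) (+ 1) c
sharpEntry (+ t) c =                          -- t ≥ 2, r ∈ {2k, 2k+1}, k = ⌊t/2⌋ ≥ 1
  inRange (ℤ.- + (2 ℕ.* (t / 2) ℕ.+ 1)) (ℤ.- + (2 ℕ.* (t / 2) ∸ 2)) c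
sharpEntry -[1+ 0 ] c = inRange (ℤ.- + 1) (+ 3) c
-- r = -(t+1) with t+1 ≥ 2, r ∈ {-2k-1, -2k}, k = ⌊(t+1)/2⌋ ≥ 1
sharpEntry -[1+ t ] c =
  inRange (+ (2 ℕ.* (suc t / 2))) (+ (2 ℕ.* (suc t / 2) ℕ.+ 3)) c

Λ# : (m : ℕ) → Pattern (2 ℕ.* m)
Λ# m i j = sharpEntry (offset m (toℕ i)) (offset m (toℕ j))

-- Both matrices have the form Z = Vᵀ K V.  V is block diagonal, with the rotation
-- (3/5, 4/5; -4/5, 3/5) on every block of two consecutive indices and 1 on every singleton
-- block, and K is a symmetric involution; so Z is symmetric with Z² = I, i.e. Z ∈ O_n(ℚ).
-- K is the anti-identity (entries with a + b = n - 1), for even n = 2m with its corner on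
-- {m - 1, m} replaced by a reflection.  K has at most one nonzero entry between any two
-- blocks, so nothing cancels in Vᵀ K V: Z i j ≠ 0 exactly when the blocks of i and j are
-- joined by a nonzero entry of K.  The anti-identity maps the block of i onto an interval,
-- so row i of the pattern is an interval of blocks, and the blocks are chosen so that
-- these intervals are the rows of Λ_n, respectively Λ_n^#.

module Submission where

open import Defs
open import Data.Nat using (ℕ; zero; suc; _+_; _*_; _≤_; _<_; z≤n; s≤s)
open import Data.Product using (_×_; ∃; _,_)
open import Relation.Binary.PropositionalEquality using (_≡_; _≢_)

module Basics where
  open import Data.Nat using (zero; suc; _+_; _*_; _/_; _≤_; _≤ᵇ_; z≤n; s≤s; ⌊_/2⌋)
  open import Data.Nat.Properties
    using (*-suc; *-monoʳ-≤; ⌊n/2⌋-mono; ≤-trans; ≤-pred; ≤ᵇ⇒≤; ≤⇒≤ᵇ; _≤?_; ≰⇒>; +-cancelʳ-≤; +-monoˡ-≤)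
  open import Data.Nat.DivMod using (m/n≡1+[m∸n]/n)
  open import Data.Bool using (Bool; true; false; _∧_)
  open import Data.Bool.Properties using (T-≡)
  open import Data.Product using (_×_; _,_; proj₂)
  open import Data.Sum using (_⊎_; inj₁; inj₂; [_,_]′)
  open import Data.Empty using (⊥-elim)
  open import Relation.Nullary using (¬_; Dec; yes; no)
  open import Function using (_∘_; _∘′_; _⇔_; mk⇔; Equivalence)
  open Equivalence using (to; from)
  open import Relation.Binary.PropositionalEquality

  2*-suc : ∀ k → 2 * suc k ≡ suc (suc (2 * k))
  2*-suc = *-suc 2

  ⌊2*+/2⌋ : ∀ k r → ⌊ 2 * k + r /2⌋ ≡ k + ⌊ r /2⌋
  ⌊2*+/2⌋ zero    r = refl
  ⌊2*+/2⌋ (suc k) r = trans (cong (λ z → ⌊ z + r /2⌋) (2*-suc k)) (cong suc (⌊2*+/2⌋ k r))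

  ⌊2*/2⌋ : ∀ k → ⌊ 2 * k /2⌋ ≡ k
  ⌊2*/2⌋ zero    = refl
  ⌊2*/2⌋ (suc k) = trans (cong ⌊_/2⌋ (2*-suc k)) (cong suc (⌊2*/2⌋ k))

  ⌊1+2*/2⌋ : ∀ k → ⌊ suc (2 * k) /2⌋ ≡ k
  ⌊1+2*/2⌋ zero    = refl
  ⌊1+2*/2⌋ (suc k) = trans (cong (⌊_/2⌋ ∘′ suc) (2*-suc k)) (cong suc (⌊1+2*/2⌋ k))

  2*⌊/2⌋≤ : ∀ y → 2 * ⌊ y /2⌋ ≤ y
  2*⌊/2⌋≤ zero          = z≤n
  2*⌊/2⌋≤ (suc zero)    = z≤n
  2*⌊/2⌋≤ (suc (suc y)) = subst (_≤ suc (suc y)) (sym (2*-suc ⌊ y /2⌋)) (s≤s (s≤s (2*⌊/2⌋≤ y)))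

  ≤1+2*⌊/2⌋ : ∀ y → y ≤ suc (2 * ⌊ y /2⌋)
  ≤1+2*⌊/2⌋ zero          = z≤n
  ≤1+2*⌊/2⌋ (suc zero)    = s≤s z≤n
  ≤1+2*⌊/2⌋ (suc (suc y)) = subst (suc (suc y) ≤_) (cong suc (sym (2*-suc ⌊ y /2⌋))) (s≤s (s≤s (≤1+2*⌊/2⌋ y)))

  2*≤⇔≤⌊/2⌋ : ∀ {a y} → 2 * a ≤ y ⇔ a ≤ ⌊ y /2⌋
  2*≤⇔≤⌊/2⌋ {a} {y} = mk⇔
    (λ 2a≤y → subst (_≤ ⌊ y /2⌋) (⌊2*/2⌋ a) (⌊n/2⌋-mono 2a≤y))
    (λ a≤y/2 → ≤-trans (*-monoʳ-≤ 2 a≤y/2) (2*⌊/2⌋≤ y))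

  ⌊/2⌋≤⇔≤1+2* : ∀ {y b} → ⌊ y /2⌋ ≤ b ⇔ y ≤ suc (2 * b)
  ⌊/2⌋≤⇔≤1+2* {y} {b} = mk⇔
    (λ y/2≤b → ≤-trans (≤1+2*⌊/2⌋ y) (s≤s (*-monoʳ-≤ 2 y/2≤b)))
    (λ y≤1+2b → subst (⌊ y /2⌋ ≤_) (⌊1+2*/2⌋ b) (⌊n/2⌋-mono y≤1+2b))

  /2≡⌊/2⌋ : ∀ s → s / 2 ≡ ⌊ s /2⌋
  /2≡⌊/2⌋ zero          = refl
  /2≡⌊/2⌋ (suc zero)    = refl
  /2≡⌊/2⌋ (suc (suc s)) = trans (m/n≡1+[m∸n]/n {suc (suc s)} {2} (s≤s (s≤s z≤n))) (cong suc (/2≡⌊/2⌋ s))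

  parity : ∀ x → x ≡ 2 * ⌊ x /2⌋ ⊎ x ≡ suc (2 * ⌊ x /2⌋)
  parity zero          = inj₁ refl
  parity (suc zero)    = inj₂ refl
  parity (suc (suc x)) with parity x
  ... | inj₁ x≡2k  = inj₁ (trans (cong (suc ∘′ suc) x≡2k) (sym (2*-suc ⌊ x /2⌋)))
  ... | inj₂ x≡2k+1 = inj₂ (trans (cong (suc ∘′ suc) x≡2k+1) (cong suc (sym (2*-suc ⌊ x /2⌋))))

  ≤ᵇ⇔≤ : ∀ {a b} → (a ≤ᵇ b) ≡ true ⇔ a ≤ b
  ≤ᵇ⇔≤ {a} {b} = mk⇔ (≤ᵇ⇒≤ a b ∘′ from T-≡) (to T-≡ ∘′ ≤⇒≤ᵇ)

  ∧⇔× : ∀ {x y} → (x ∧ y) ≡ true ⇔ (x ≡ true × y ≡ true)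
  ∧⇔× {true}  = mk⇔ (refl ,_) proj₂
  ∧⇔× {false} = mk⇔ (λ ()) (λ ())

  ≡⇒⇔ : ∀ {A B : Set} → A ≡ B → A ⇔ B
  ≡⇒⇔ refl = mk⇔ (λ a → a) (λ b → b)

  both : ∀ {A B : Set} → A → B → A ⇔ B
  both a b = mk⇔ (λ _ → b) (λ _ → a)

  neither : ∀ {A B : Set} → ¬ A → ¬ B → A ⇔ B
  neither ¬a ¬b = mk⇔ (⊥-elim ∘ ¬a) (⊥-elim ∘ ¬b)

  cancel⇔ : ∀ k {a b a' b'} → a ≡ a' + k → b ≡ b' + k → (a ≤ b) ⇔ (a' ≤ b')
  cancel⇔ k {a' = a'} {b'} refl refl = mk⇔ (+-cancelʳ-≤ k a' b') (+-monoˡ-≤ k)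

  interval-∪ : ∀ {a b a' b' h} → a' ≤ a → a ≤ suc b' → b' ≤ b →
               ((a ≤ h × h ≤ b) ⊎ (a' ≤ h × h ≤ b')) ⇔ (a' ≤ h × h ≤ b)
  interval-∪ {a} {b} {a'} {b'} {h} a'≤a a≤1+b' b'≤b = mk⇔
    [ (λ (a≤h , h≤b) → ≤-trans a'≤a a≤h , h≤b) , (λ (a'≤h , h≤b') → a'≤h , ≤-trans h≤b' b'≤b) ]′
    (λ (a'≤h , h≤b) → case′ (a ≤? h) a'≤h h≤b)
    where
    case′ : Dec (a ≤ h) → a' ≤ h → h ≤ b → (a ≤ h × h ≤ b) ⊎ (a' ≤ h × h ≤ b')
    case′ (yes a≤h) _ h≤b = inj₁ (a≤h , h≤b)
    case′ (no  a≰h) a'≤h _ = inj₂ (a'≤h , ≤-pred (≤-trans (≰⇒> a≰h) a≤1+b'))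

module Offsets where
  open import Data.Nat as ℕ using (ℕ; suc)
  import Data.Nat.Properties as ℕ
  open import Data.Integer as ℤ using (ℤ; +_; -[1+_]; _-_; -_; +≤+) renaming (_+_ to _⊕_)
  import Data.Integer.Properties as ℤ
  open import Data.Integer.Tactic.RingSolver using (solve-∀)
  open import Data.Bool using (true)
  open import Data.Bool.Properties using (T-≡)
  open import Data.Product using (_×_; _,_)
  open import Function using (_⇔_; mk⇔; Equivalence)
  open import Function.Properties.Equivalence using () renaming (trans to ⇔-trans)
  open import Relation.Binary.PropositionalEquality
  open Basics using (∧⇔×; ≡⇒⇔)
  open Equivalence using (to; from)

  difference-≤⇔ : ∀ a b p s → (+ a - + b ℤ.≤ + p - + s) ⇔ (a ℕ.+ s ℕ.≤ p ℕ.+ b)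
  difference-≤⇔ a b p s = mk⇔
    (λ le → ℤ.drop‿+≤+ (subst₂ ℤ._≤_ left right (ℤ.+-monoˡ-≤ t le)))
    (λ le → subst₂ ℤ._≤_ (cancel (+ a - + b)) (cancel (+ p - + s))
                         (ℤ.+-monoˡ-≤ (- t) (subst₂ ℤ._≤_ (sym left) (sym right) (+≤+ le))))
    where
    t : ℤ
    t = + b ⊕ + s
    shift : ∀ a b s → (a - b) ⊕ (b ⊕ s) ≡ a ⊕ s
    shift = solve-∀
    left : (+ a - + b) ⊕ t ≡ + (a ℕ.+ s)
    left = trans (shift (+ a) (+ b) (+ s)) (sym (ℤ.pos-+ a s))
    right : (+ p - + s) ⊕ t ≡ + (p ℕ.+ b)
    right = trans (trans (cong ((+ p - + s) ⊕_) (ℤ.+-comm (+ b) (+ s))) (shift (+ p) (+ s) (+ b))) (sym (ℤ.pos-+ p b))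
    cancel : ∀ i → (i ⊕ t) ⊕ (- t) ≡ i
    cancel i = ring i t
      where
      ring : ∀ i t → (i ⊕ t) ⊕ (- t) ≡ i
      ring = solve-∀

  -K≤difference⇔ : ∀ K a b → (- (+ K) ℤ.≤ + a - + b) ⇔ (b ℕ.≤ a ℕ.+ K)
  -K≤difference⇔ K a b = ⇔-trans (≡⇒⇔ (cong (ℤ._≤ + a - + b) (sym (ℤ.+-identityˡ (- + K))))) (difference-≤⇔ 0 K a b)

  +K≤difference⇔ : ∀ K a b → (+ K ℤ.≤ + a - + b) ⇔ (K ℕ.+ b ℕ.≤ a)
  +K≤difference⇔ K a b = ⇔-trans (≡⇒⇔ (cong (ℤ._≤ + a - + b) (sym (ℤ.+-identityʳ (+ K)))))
                                 (⇔-trans (difference-≤⇔ K 0 a b) (≡⇒⇔ (cong (K ℕ.+ b ℕ.≤_) (ℕ.+-identityʳ a))))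

  difference≤-K⇔ : ∀ K a b → (+ a - + b ℤ.≤ - (+ K)) ⇔ (a ℕ.+ K ℕ.≤ b)
  difference≤-K⇔ K a b = ⇔-trans (≡⇒⇔ (cong (+ a - + b ℤ.≤_) (sym (ℤ.+-identityˡ (- + K))))) (difference-≤⇔ a b 0 K)

  difference≤+K⇔ : ∀ K a b → (+ a - + b ℤ.≤ + K) ⇔ (a ℕ.≤ K ℕ.+ b)
  difference≤+K⇔ K a b = ⇔-trans (≡⇒⇔ (cong (+ a - + b ℤ.≤_) (sym (ℤ.+-identityʳ (+ K)))))
                                 (⇔-trans (difference-≤⇔ a b K 0) (≡⇒⇔ (cong (ℕ._≤ K ℕ.+ b) (ℕ.+-identityʳ a))))

  inRange⇔ : ∀ {i j k} → inRange i j k ≡ true ⇔ (i ℤ.≤ k × k ℤ.≤ j)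
  inRange⇔ = mk⇔
    (λ r → let (lower , upper) = to ∧⇔× r in ℤ.≤ᵇ⇒≤ (from T-≡ lower) , ℤ.≤ᵇ⇒≤ (from T-≡ upper))
    (λ (lower , upper) → from ∧⇔× (to T-≡ (ℤ.≤⇒≤ᵇ lower) , to T-≡ (ℤ.≤⇒≤ᵇ upper)))

  difference-+ : ∀ b k → + (b ℕ.+ k) - + b ≡ + k
  difference-+ b k = trans (cong (_- + b) (ℤ.pos-+ b k)) (ring (+ b) (+ k))
    where
    ring : ∀ b k → (b ⊕ k) - b ≡ k
    ring = solve-∀

  difference-- : ∀ a t → + a - + (a ℕ.+ suc t) ≡ -[1+ t ]
  difference-- a t = trans (cong (_-_ (+ a)) (ℤ.pos-+ a (suc t))) (ring (+ a) (+ suc t))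
    where
    ring : ∀ a k → a - (a ⊕ k) ≡ - k
    ring = solve-∀

module FinSum where
  open import Data.Nat using (ℕ; zero; suc; _<_; z≤n; s≤s)
  open import Data.Nat.Properties using (suc-injective)
  open import Data.Fin using (toℕ)
  open import Data.Rational as ℚ using (ℚ; 0ℚ)
  open import Algebra.Bundles using (CommutativeRing)
  open import Data.Rational.Properties using (+-*-commutativeRing; +-identityˡ; +-identityʳ; +-comm; _≟_)
  open import Data.Product using (∃; _×_; _,_)
  open import Data.Empty using (⊥-elim)
  open import Relation.Nullary using (yes; no)
  open import Relation.Binary.PropositionalEquality
  open import Function using (_∘_)
  open import Algebra.Properties.Semiring.Sum (CommutativeRing.semiring +-*-commutativeRing)
    using (sum; ∑-comm; *-distribˡ-sum; *-distribʳ-sum)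

  ∑< : ℕ → (ℕ → ℚ) → ℚ
  ∑< n f = sum {n} (λ k → f (toℕ k))

  ∑<-cong : ∀ n {f g : ℕ → ℚ} → (∀ k → k < n → f k ≡ g k) → ∑< n f ≡ ∑< n g
  ∑<-cong zero    eq = refl
  ∑<-cong (suc n) eq = cong₂ ℚ._+_ (eq 0 (s≤s z≤n)) (∑<-cong n (λ k k<n → eq (suc k) (s≤s k<n)))

  ∑<-zero : ∀ n {f : ℕ → ℚ} → (∀ k → k < n → f k ≡ 0ℚ) → ∑< n f ≡ 0ℚ
  ∑<-zero n eq = trans (∑<-cong n eq) (zeros n)
    where
    zeros : ∀ n → ∑< n (λ _ → 0ℚ) ≡ 0ℚ
    zeros zero    = refl
    zeros (suc n) = trans (+-identityˡ _) (zeros n)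

  ∑<-single : ∀ n {f : ℕ → ℚ} p → p < n → (∀ k → k < n → k ≢ p → f k ≡ 0ℚ) → ∑< n f ≡ f p
  ∑<-single (suc n) {f} zero    _         vanish =
    trans (cong (f 0 ℚ.+_) (∑<-zero n (λ k k<n → vanish (suc k) (s≤s k<n) λ ()))) (+-identityʳ (f 0))
  ∑<-single (suc n) {f} (suc p) (s≤s p<n) vanish =
    trans (cong₂ ℚ._+_ (vanish 0 (s≤s z≤n) λ ())
                       (∑<-single n p p<n λ k k<n k≢p → vanish (suc k) (s≤s k<n) (k≢p ∘ suc-injective)))
          (+-identityˡ _)

  ∑<-pair : ∀ n {f : ℕ → ℚ} p q → p < n → q < n → p ≢ q →
            (∀ k → k < n → k ≢ p → k ≢ q → f k ≡ 0ℚ) → ∑< n f ≡ f p ℚ.+ f q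
  ∑<-pair (suc n)     zero    zero    _         _         p≢q _ = ⊥-elim (p≢q refl)
  ∑<-pair (suc n) {f} zero    (suc q) _         (s≤s q<n) _   vanish =
    cong (f 0 ℚ.+_) (∑<-single n q q<n λ k k<n k≢q → vanish (suc k) (s≤s k<n) (λ ()) (k≢q ∘ suc-injective))
  ∑<-pair (suc n) {f} (suc p) zero    (s≤s p<n) _         _   vanish =
    trans (cong (f 0 ℚ.+_) (∑<-single n p p<n λ k k<n k≢p → vanish (suc k) (s≤s k<n) (k≢p ∘ suc-injective) (λ ())))
          (+-comm (f 0) (f (suc p)))
  ∑<-pair (suc n) {f} (suc p) (suc q) (s≤s p<n) (s≤s q<n) p≢q vanish =
    trans (cong₂ ℚ._+_ (vanish 0 (s≤s z≤n) (λ ()) (λ ()))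
                     (∑<-pair n p q p<n q<n (p≢q ∘ cong suc)
                        λ k k<n k≢p k≢q → vanish (suc k) (s≤s k<n) (k≢p ∘ suc-injective) (k≢q ∘ suc-injective)))
          (+-identityˡ _)

  ∑<-comm : ∀ n p (f : ℕ → ℕ → ℚ) → ∑< n (λ i → ∑< p (f i)) ≡ ∑< p (λ j → ∑< n (λ i → f i j))
  ∑<-comm n p f = ∑-comm {n} {p} (λ i j → f (toℕ i) (toℕ j))

  *-distribˡ-∑< : ∀ n x (f : ℕ → ℚ) → x ℚ.* ∑< n f ≡ ∑< n (λ k → x ℚ.* f k)
  *-distribˡ-∑< n x f = *-distribˡ-sum {n} x (λ k → f (toℕ k))

  *-distribʳ-∑< : ∀ n x (f : ℕ → ℚ) → ∑< n f ℚ.* x ≡ ∑< n (λ k → f k ℚ.* x)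
  *-distribʳ-∑< n x f = *-distribʳ-sum {n} x (λ k → f (toℕ k))

  ∑<-nonzero⇒ : ∀ n {f : ℕ → ℚ} → ∑< n f ≢ 0ℚ → ∃ λ k → k < n × f k ≢ 0ℚ
  ∑<-nonzero⇒ zero    nz = ⊥-elim (nz refl)
  ∑<-nonzero⇒ (suc n) {f} nz with f 0 ≟ 0ℚ
  ... | no f0≢0 = 0 , s≤s z≤n , f0≢0
  ... | yes f0≡0 with ∑<-nonzero⇒ n {f ∘ suc} (λ rest≡0 → nz (trans (cong₂ ℚ._+_ f0≡0 rest≡0) (+-identityˡ 0ℚ)))
  ...   | k , k<n , fk≢0 = suc k , s≤s k<n , fk≢0

module SquareMatrix where
  open import Data.Nat using (ℕ; zero; suc; _<_)
  import Data.Nat as ℕ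
  open import Data.Nat.Properties using (suc-injective)
  open import Data.Fin using (Fin; toℕ) renaming (zero to fzero; suc to fsuc)
  open import Data.Fin.Properties using (toℕ<n)
  open import Data.Rational as ℚ using (ℚ; 0ℚ; 1ℚ)
  open import Data.Rational.Properties using (*-assoc; *-comm; *-identityˡ; *-identityʳ; *-zeroˡ; *-zeroʳ)
  open import Data.Product using (_×_; _,_)
  open import Data.Empty using (⊥-elim)
  open import Function using (_∘_)
  open import Relation.Nullary using (yes; no)
  open import Relation.Binary.PropositionalEquality
  open ≡-Reasoning
  open FinSum

  -- Square matrices are functions on ℕ; only the entries below the dimension given to
  -- _·[_]_ and _≈[_]_ matter.
  Mat : Set
  Mat = ℕ → ℕ → ℚ

  infixl 7 _·[_]_
  infix 4 _≈[_]_

  _·[_]_ : Mat → ℕ → Mat → Mat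
  (A ·[ n ] B) i j = ∑< n (λ k → A i k ℚ.* B k j)

  _ᵀ : Mat → Mat
  (A ᵀ) i j = A j i

  𝟙 : Mat
  𝟙 i j with i ℕ.≟ j
  ... | yes _ = 1ℚ
  ... | no  _ = 0ℚ

  _≈[_]_ : Mat → ℕ → Mat → Set
  A ≈[ n ] B = ∀ i j → i < n → j < n → A i j ≡ B i j

  Symmetric : Mat → Set
  Symmetric A = ∀ i j → A i j ≡ A j i

  Orthogonal : ℕ → Mat → Set
  Orthogonal n A = (A ·[ n ] A ᵀ ≈[ n ] 𝟙) × (A ᵀ ·[ n ] A ≈[ n ] 𝟙)

  𝟙-diag : ∀ i → 𝟙 i i ≡ 1ℚ
  𝟙-diag i with i ℕ.≟ i
  ... | yes _   = refl
  ... | no  i≢i = ⊥-elim (i≢i refl)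

  𝟙-offdiag : ∀ {i j} → i ≢ j → 𝟙 i j ≡ 0ℚ
  𝟙-offdiag {i} {j} i≢j with i ℕ.≟ j
  ... | yes i≡j = ⊥-elim (i≢j i≡j)
  ... | no  _   = refl

  module _ (n : ℕ) where

    ·-assoc : ∀ A B C i j → (A ·[ n ] B ·[ n ] C) i j ≡ (A ·[ n ] (B ·[ n ] C)) i j
    ·-assoc A B C i j = begin
      ∑< n (λ k → ∑< n (λ l → A i l ℚ.* B l k) ℚ.* C k j)
        ≡⟨ ∑<-cong n (λ k _ → *-distribʳ-∑< n (C k j) (λ l → A i l ℚ.* B l k)) ⟩
      ∑< n (λ k → ∑< n (λ l → A i l ℚ.* B l k ℚ.* C k j))
        ≡⟨ ∑<-comm n n (λ k l → A i l ℚ.* B l k ℚ.* C k j) ⟩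
      ∑< n (λ l → ∑< n (λ k → A i l ℚ.* B l k ℚ.* C k j))
        ≡⟨ ∑<-cong n (λ l _ → ∑<-cong n (λ k _ → *-assoc (A i l) (B l k) (C k j))) ⟩
      ∑< n (λ l → ∑< n (λ k → A i l ℚ.* (B l k ℚ.* C k j)))
        ≡⟨ ∑<-cong n (λ l _ → *-distribˡ-∑< n (A i l) (λ k → B l k ℚ.* C k j)) ⟨
      ∑< n (λ l → A i l ℚ.* ∑< n (λ k → B l k ℚ.* C k j)) ∎

    ·-congˡ : ∀ {A A'} B {i} j → A ≈[ n ] A' → i < n → (A ·[ n ] B) i j ≡ (A' ·[ n ] B) i j
    ·-congˡ B j A≈A' i<n = ∑<-cong n (λ k k<n → cong (ℚ._* B k j) (A≈A' _ k i<n k<n))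

    ·-congʳ : ∀ A {B B'} i {j} → B ≈[ n ] B' → j < n → (A ·[ n ] B) i j ≡ (A ·[ n ] B') i j
    ·-congʳ A i B≈B' j<n = ∑<-cong n (λ k k<n → cong (A i k ℚ.*_) (B≈B' k _ k<n j<n))

    ·-identityˡ : ∀ A {i} j → i < n → (𝟙 ·[ n ] A) i j ≡ A i j
    ·-identityˡ A {i} j i<n =
      trans (∑<-single n i i<n (λ k _ k≢i → trans (cong (ℚ._* A k j) (𝟙-offdiag (k≢i ∘ sym))) (*-zeroˡ (A k j))))
            (trans (cong (ℚ._* A i j) (𝟙-diag i)) (*-identityˡ _))

    ·-identityʳ : ∀ A i {j} → j < n → (A ·[ n ] 𝟙) i j ≡ A i j
    ·-identityʳ A i {j} j<n =
      trans (∑<-single n j j<n (λ k _ k≢j → trans (cong (A i k ℚ.*_) (𝟙-offdiag k≢j)) (*-zeroʳ (A i k))))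
            (trans (cong (A i j ℚ.*_) (𝟙-diag j)) (*-identityʳ _))

    symmetric-involution⇒orthogonal : ∀ {A} → Symmetric A → A ·[ n ] A ≈[ n ] 𝟙 → Orthogonal n A
    symmetric-involution⇒orthogonal {A} sym-A A²≈𝟙 =
      (λ i j i<n j<n → trans (∑<-cong n (λ k _ → cong (A i k ℚ.*_) (sym-A j k))) (A²≈𝟙 i j i<n j<n)) ,
      (λ i j i<n j<n → trans (∑<-cong n (λ k _ → cong (ℚ._* A k j) (sym-A k i))) (A²≈𝟙 i j i<n j<n))

    conj : Mat → Mat → Mat
    conj V K = V ᵀ ·[ n ] (K ·[ n ] V)

    conj-entry : ∀ V K i j → conj V K i j ≡ ∑< n (λ a → ∑< n (λ b → V a i ℚ.* (K a b ℚ.* V b j)))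
    conj-entry V K i j = ∑<-cong n (λ a _ → *-distribˡ-∑< n (V a i) (λ b → K a b ℚ.* V b j))

    conj-symmetric : ∀ V {K} → Symmetric K → Symmetric (conj V K)
    conj-symmetric V {K} sym-K i j = begin
      conj V K i j
        ≡⟨ conj-entry V K i j ⟩
      ∑< n (λ a → ∑< n (λ b → V a i ℚ.* (K a b ℚ.* V b j)))
        ≡⟨ ∑<-comm n n (λ a b → V a i ℚ.* (K a b ℚ.* V b j)) ⟩
      ∑< n (λ b → ∑< n (λ a → V a i ℚ.* (K a b ℚ.* V b j)))
        ≡⟨ ∑<-cong n (λ b _ → ∑<-cong n (λ a _ → swap a b)) ⟩
      ∑< n (λ b → ∑< n (λ a → V b j ℚ.* (K b a ℚ.* V a i)))
        ≡⟨ conj-entry V K j i ⟨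
      conj V K j i ∎
      where
      swap : ∀ a b → V a i ℚ.* (K a b ℚ.* V b j) ≡ V b j ℚ.* (K b a ℚ.* V a i)
      swap a b = begin
        V a i ℚ.* (K a b ℚ.* V b j)  ≡⟨ cong (V a i ℚ.*_) (*-comm (K a b) (V b j)) ⟩
        V a i ℚ.* (V b j ℚ.* K a b)  ≡⟨ *-assoc (V a i) (V b j) (K a b) ⟨
        V a i ℚ.* V b j ℚ.* K a b    ≡⟨ cong₂ ℚ._*_ (*-comm (V a i) (V b j)) (sym-K a b) ⟩
        V b j ℚ.* V a i ℚ.* K b a    ≡⟨ *-assoc (V b j) (V a i) (K b a) ⟩
        V b j ℚ.* (V a i ℚ.* K b a)  ≡⟨ cong (V b j ℚ.*_) (*-comm (V a i) (K b a)) ⟩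
        V b j ℚ.* (K b a ℚ.* V a i)  ∎

    conj-involutive : ∀ {V K} → Orthogonal n V → K ·[ n ] K ≈[ n ] 𝟙 → conj V K ·[ n ] conj V K ≈[ n ] 𝟙
    conj-involutive {V} {K} (VVᵀ≈𝟙 , VᵀV≈𝟙) K²≈𝟙 i j i<n j<n = begin
      (Z ·[ n ] (V ᵀ ·[ n ] W)) i j  ≡⟨ ·-assoc Z (V ᵀ) W i j ⟨
      (Z ·[ n ] V ᵀ ·[ n ] W) i j    ≡⟨ ·-congˡ W j ZVᵀ≈VᵀK i<n ⟩
      (V ᵀ ·[ n ] K ·[ n ] W) i j    ≡⟨ ·-assoc (V ᵀ) K W i j ⟩
      (V ᵀ ·[ n ] (K ·[ n ] W)) i j  ≡⟨ ·-congʳ (V ᵀ) i KW≈V j<n ⟩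
      (V ᵀ ·[ n ] V) i j             ≡⟨ VᵀV≈𝟙 i j i<n j<n ⟩
      𝟙 i j                          ∎
      where
      W Z : Mat
      W = K ·[ n ] V
      Z = V ᵀ ·[ n ] W
      WVᵀ≈K : W ·[ n ] V ᵀ ≈[ n ] K
      WVᵀ≈K a b _ b<n = begin
        (K ·[ n ] V ·[ n ] V ᵀ) a b    ≡⟨ ·-assoc K V (V ᵀ) a b ⟩
        (K ·[ n ] (V ·[ n ] V ᵀ)) a b  ≡⟨ ·-congʳ K a VVᵀ≈𝟙 b<n ⟩
        (K ·[ n ] 𝟙) a b               ≡⟨ ·-identityʳ K a b<n ⟩
        K a b                          ∎
      ZVᵀ≈VᵀK : Z ·[ n ] V ᵀ ≈[ n ] V ᵀ ·[ n ] K
      ZVᵀ≈VᵀK a b _ b<n = trans (·-assoc (V ᵀ) W (V ᵀ) a b) (·-congʳ (V ᵀ) a WVᵀ≈K b<n)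
      KW≈V : K ·[ n ] W ≈[ n ] V
      KW≈V a b a<n _ = begin
        (K ·[ n ] (K ·[ n ] V)) a b  ≡⟨ ·-assoc K K V a b ⟨
        (K ·[ n ] K ·[ n ] V) a b    ≡⟨ ·-congˡ V b K²≈𝟙 a<n ⟩
        (𝟙 ·[ n ] V) a b             ≡⟨ ·-identityˡ V b a<n ⟩
        V a b                        ∎

    toMatrix : Mat → Matrix n
    toMatrix A i j = A (toℕ i) (toℕ j)

  sumFin≡∑< : ∀ n (f : ℕ → ℚ) → sumFin n (f ∘ toℕ) ≡ ∑< n f
  sumFin≡∑< zero    f = refl
  sumFin≡∑< (suc n) f = cong (f 0 ℚ.+_) (sumFin≡∑< n (f ∘ suc))

  identity≡𝟙 : ∀ {n} (i j : Fin n) → identity i j ≡ 𝟙 (toℕ i) (toℕ j)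
  identity≡𝟙 fzero    fzero    = sym (𝟙-diag 0)
  identity≡𝟙 fzero    (fsuc j) = refl
  identity≡𝟙 (fsuc i) fzero    = refl
  identity≡𝟙 (fsuc i) (fsuc j) = trans (identity≡𝟙 i j) (𝟙-suc (toℕ i) (toℕ j))
    where
    𝟙-suc : ∀ a b → 𝟙 a b ≡ 𝟙 (suc a) (suc b)
    𝟙-suc a b with a ℕ.≟ b
    ... | yes refl = sym (𝟙-diag (suc a))
    ... | no  a≢b  = sym (𝟙-offdiag (a≢b ∘ suc-injective))

  toMatrix-symmetric : ∀ n {A} → Symmetric A → IsSymmetric (toMatrix n A)
  toMatrix-symmetric n sym-A i j = sym-A (toℕ i) (toℕ j)

  toMatrix-orthogonal : ∀ n {A} → Orthogonal n A → IsOrthogonal (toMatrix n A)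
  toMatrix-orthogonal n {A} (AAᵀ≈𝟙 , AᵀA≈𝟙) = entrywise {A} {A ᵀ} AAᵀ≈𝟙 , entrywise {A ᵀ} {A} AᵀA≈𝟙
    where
    entrywise : ∀ {B C} → B ·[ n ] C ≈[ n ] 𝟙 → ∀ i j → (toMatrix n B ⊗ toMatrix n C) i j ≡ identity i j
    entrywise {B} {C} BC≈𝟙 i j =
      trans (sumFin≡∑< n (λ k → B (toℕ i) k ℚ.* C k (toℕ j)))
            (trans (BC≈𝟙 (toℕ i) (toℕ j) (toℕ<n i) (toℕ<n j)) (sym (identity≡𝟙 i j)))

module TwoByTwo where
  open import Data.Bool using (Bool; true; false)
  open import Data.Integer using (+_)
  open import Data.Rational as ℚ using (ℚ; 0ℚ; 1ℚ; _/_)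
  open import Relation.Binary.PropositionalEquality

  Mat₂ : Set
  Mat₂ = Bool → Bool → ℚ

  _ᵀ₂ : Mat₂ → Mat₂
  (ρ ᵀ₂) u w = ρ w u

  δ₂ : Mat₂
  δ₂ true  true  = 1ℚ
  δ₂ false false = 1ℚ
  δ₂ _     _     = 0ℚ

  RowOrthonormal₂ : Mat₂ → Set
  RowOrthonormal₂ ρ = ∀ u w → ρ u true ℚ.* ρ w true ℚ.+ ρ u false ℚ.* ρ w false ≡ δ₂ u w

  NowhereZero₂ : Mat₂ → Set
  NowhereZero₂ ρ = ∀ u w → ρ u w ≢ 0ℚ

  rotation : Mat₂
  rotation true  true  = + 3 / 5
  rotation true  false = + 4 / 5
  rotation false true  = ℚ.- (+ 4 / 5)
  rotation false false = + 3 / 5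

  rotation-rows : RowOrthonormal₂ rotation
  rotation-rows true  true  = refl
  rotation-rows true  false = refl
  rotation-rows false true  = refl
  rotation-rows false false = refl

  rotation-columns : RowOrthonormal₂ (rotation ᵀ₂)
  rotation-columns true  true  = refl
  rotation-columns true  false = refl
  rotation-columns false true  = refl
  rotation-columns false false = refl

  rotation-nowhereZero : NowhereZero₂ rotation
  rotation-nowhereZero true  true  ()
  rotation-nowhereZero true  false ()
  rotation-nowhereZero false true  ()
  rotation-nowhereZero false false ()

  reflection : Mat₂
  reflection true  true  = + 3 / 5
  reflection true  false = + 4 / 5
  reflection false true  = + 4 / 5
  reflection false false = ℚ.- (+ 3 / 5)

  reflection-symmetric : ∀ u w → reflection u w ≡ reflection w u
  reflection-symmetric true  true  = refl
  reflection-symmetric true  false = refl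
  reflection-symmetric false true  = refl
  reflection-symmetric false false = refl

  reflection-rows : RowOrthonormal₂ reflection
  reflection-rows true  true  = refl
  reflection-rows true  false = refl
  reflection-rows false true  = refl
  reflection-rows false false = refl

  reflection-nowhereZero : NowhereZero₂ reflection
  reflection-nowhereZero true  true  ()
  reflection-nowhereZero true  false ()
  reflection-nowhereZero false true  ()
  reflection-nowhereZero false false ()

module BlockPartition (n : ℕ) (q : ℕ → ℕ) (q-strict : ∀ x → q x < q (suc x)) where
  open import Data.Nat
    using (ℕ; zero; suc; _+_; _*_; _<_; _≤_; _≤′_; ≤′-refl; ≤′-step; z≤n; s≤s; ⌊_/2⌋; _≟_; _<?_)
  open import Data.Nat.Properties
  open import Data.Product using (_×_; _,_; ∃; proj₁; proj₂)
  open import Relation.Binary using (tri<; tri≈; tri>)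
  open import Data.Sum using (_⊎_; inj₁; inj₂)
  open import Data.Empty using (⊥; ⊥-elim)
  open import Function using (_∘_; _⇔_; mk⇔)
  open import Relation.Nullary using (yes; no)
  open import Relation.Binary.PropositionalEquality
  open Basics using (⌊2*/2⌋; ⌊1+2*/2⌋; 2*⌊/2⌋≤; ≤1+2*⌊/2⌋)
  open ≤-Reasoning

  -- The blocks are the fibres of H = ⌊q/2⌋.  As q is strictly increasing, each block is
  -- [lo x, hi x] with at most two elements, and it is a pair when q takes both values
  -- 2h and 2h + 1 on it.
  H : ℕ → ℕ
  H x = ⌊ q x /2⌋

  q-mono-≤ : ∀ {x y} → x ≤ y → q x ≤ q y
  q-mono-≤ = go ∘ ≤⇒≤′
    where
    go : ∀ {x y} → x ≤′ y → q x ≤ q y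
    go ≤′-refl       = ≤-refl
    go (≤′-step x≤y) = ≤-trans (go x≤y) (<⇒≤ (q-strict _))

  q-mono-< : ∀ {x y} → x < y → q x < q y
  q-mono-< {x} x<y = ≤-trans (q-strict x) (q-mono-≤ x<y)

  H-mono : ∀ {x y} → x ≤ y → H x ≤ H y
  H-mono = ⌊n/2⌋-mono ∘ q-mono-≤

  H-<-twoApart : ∀ {x y} → suc x < y → H x < H y
  H-<-twoApart {x} {y} x+2≤y = ⌊n/2⌋-mono (≤-trans (s≤s (q-strict x)) (≤-trans (q-strict (suc x)) (q-mono-≤ x+2≤y)))

  H≡⇒≤1+ : ∀ {x y} → H x ≡ H y → x ≤ y → y ≤ suc x
  H≡⇒≤1+ {x} {y} Hx≡Hy _ with suc x <? y
  ... | yes x+2≤y = ⊥-elim (<-irrefl Hx≡Hy (H-<-twoApart x+2≤y))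
  ... | no  x+2≰y = ≮⇒≥ x+2≰y

  lo : ℕ → ℕ
  lo zero = zero
  lo (suc x) with H x ≟ H (suc x)
  ... | yes _ = x
  ... | no  _ = suc x

  hi : ℕ → ℕ
  hi x with suc x <? n
  ... | no  _ = x
  ... | yes _ with H (suc x) ≟ H x
  ...   | yes _ = suc x
  ...   | no  _ = x

  lo≤ : ∀ x → lo x ≤ x
  lo≤ zero = z≤n
  lo≤ (suc x) with H x ≟ H (suc x)
  ... | yes _ = n≤1+n x
  ... | no  _ = ≤-refl

  lo<n : ∀ {x} → x < n → lo x < n
  lo<n {x} = ≤-<-trans (lo≤ x)

  H-lo : ∀ x → H (lo x) ≡ H x
  H-lo zero = refl
  H-lo (suc x) with H x ≟ H (suc x)
  ... | yes Hx≡Hsx = Hx≡Hsx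
  ... | no  _      = refl

  lo-least : ∀ {a x} → H a ≡ H x → lo x ≤ a
  lo-least {a} {x} Ha≡Hx with x ≤? a
  ... | yes x≤a = ≤-trans (lo≤ x) x≤a
  ... | no  x≰a = least x (≰⇒> x≰a) Ha≡Hx
    where
    least : ∀ x → a < x → H a ≡ H x → lo x ≤ a
    least (suc x) (s≤s a≤x) Ha≡Hsx with H x ≟ H (suc x) | m≤n⇒m<n∨m≡n a≤x
    ... | yes _      | _        = ≤-pred (H≡⇒≤1+ Ha≡Hsx (m≤n⇒m≤1+n a≤x))
    ... | no  Hx≢Hsx | inj₂ refl = ⊥-elim (Hx≢Hsx Ha≡Hsx)
    ... | no  _      | inj₁ a<x = ⊥-elim (<-irrefl Ha≡Hsx (H-<-twoApart (s≤s a<x)))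

  ≤hi : ∀ x → x ≤ hi x
  ≤hi x with suc x <? n
  ... | no  _ = ≤-refl
  ... | yes _ with H (suc x) ≟ H x
  ...   | yes _ = n≤1+n x
  ...   | no  _ = ≤-refl

  H-hi : ∀ x → H (hi x) ≡ H x
  H-hi x with suc x <? n
  ... | no  _ = refl
  ... | yes _ with H (suc x) ≟ H x
  ...   | yes Hsx≡Hx = Hsx≡Hx
  ...   | no  _      = refl

  hi<n : ∀ {x} → x < n → hi x < n
  hi<n {x} x<n with suc x <? n
  ... | no  _ = x<n
  ... | yes x+1<n with H (suc x) ≟ H x
  ...   | yes _ = x+1<n
  ...   | no  _ = x<n

  hi-greatest : ∀ {a x} → a < n → H a ≡ H x → a ≤ hi x
  hi-greatest {a} {x} a<n Ha≡Hx with a ≤? x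
  ... | yes a≤x = ≤-trans a≤x (≤hi x)
  ... | no  a≰x with ≤-antisym (H≡⇒≤1+ (sym Ha≡Hx) (<⇒≤ (≰⇒> a≰x))) (≰⇒> a≰x)
  ...   | refl with suc x <? n
  ...     | no  x+1≮n = ⊥-elim (x+1≮n a<n)
  ...     | yes _ with H (suc x) ≟ H x
  ...       | yes _      = ≤-refl
  ...       | no  Hsx≢Hx = ⊥-elim (Hsx≢Hx Ha≡Hx)

  hi≤1+lo : ∀ x → hi x ≤ suc (lo x)
  hi≤1+lo x = H≡⇒≤1+ (trans (H-lo x) (sym (H-hi x))) (≤-trans (lo≤ x) (≤hi x))

  sameBlock⇔ : ∀ {a x} → a < n → H a ≡ H x ⇔ (lo x ≤ a × a ≤ hi x)
  sameBlock⇔ {a} {x} a<n = mk⇔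
    (λ Ha≡Hx → lo-least Ha≡Hx , hi-greatest a<n Ha≡Hx)
    (λ (lo≤a , a≤hi) → ≤-antisym (subst (H a ≤_) (H-hi x) (H-mono a≤hi)) (subst (_≤ H a) (H-lo x) (H-mono lo≤a)))

  lo-cong : ∀ {a x} → H a ≡ H x → lo a ≡ lo x
  lo-cong Ha≡Hx = ≤-antisym (lo-least (trans (H-lo _) (sym Ha≡Hx))) (lo-least (trans (H-lo _) Ha≡Hx))

  hi-cong : ∀ {a x} → a < n → x < n → H a ≡ H x → hi a ≡ hi x
  hi-cong a<n x<n Ha≡Hx =
    ≤-antisym (hi-greatest (hi<n a<n) (trans (H-hi _) Ha≡Hx)) (hi-greatest (hi<n x<n) (trans (H-hi _) (sym Ha≡Hx)))

  block-elements : ∀ {a x} → a < n → H a ≡ H x → a ≡ lo x ⊎ a ≡ hi x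
  block-elements {a} {x} a<n Ha≡Hx with m≤n⇒m<n∨m≡n (lo-least Ha≡Hx)
  ... | inj₂ lo≡a  = inj₁ (sym lo≡a)
  ... | inj₁ lo<a = inj₂ (≤-antisym (hi-greatest a<n Ha≡Hx) (≤-trans (hi≤1+lo x) lo<a))

  singleton-element : ∀ {a x} → a < n → H a ≡ H x → lo x ≡ hi x → a ≡ lo x
  singleton-element a<n Ha≡Hx lo≡hi with block-elements a<n Ha≡Hx
  ... | inj₁ a≡lo = a≡lo
  ... | inj₂ a≡hi = trans a≡hi (sym lo≡hi)

  lo-of-even : ∀ {s x} → q s ≡ 2 * H x → lo x ≡ s
  lo-of-even {s} {x} qs≡2Hx = ≤-antisym (lo-least Hs≡Hx) (≮⇒≥ lo<s-absurd)
    where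
    Hs≡Hx : H s ≡ H x
    Hs≡Hx = trans (cong ⌊_/2⌋ qs≡2Hx) (⌊2*/2⌋ (H x))
    lo<s-absurd : lo x < s → ⊥
    lo<s-absurd lo<s = <-irrefl refl (begin-strict
      2 * H x       ≡⟨ cong (2 *_) (H-lo x) ⟨
      2 * H (lo x)  ≤⟨ 2*⌊/2⌋≤ (q (lo x)) ⟩
      q (lo x)      <⟨ q-mono-< lo<s ⟩
      q s           ≡⟨ qs≡2Hx ⟩
      2 * H x       ∎)

  hi-of-odd : ∀ {e x} → e < n → q e ≡ suc (2 * H x) → hi x ≡ e
  hi-of-odd {e} {x} e<n qe≡1+2Hx = ≤-antisym (≮⇒≥ e<hi-absurd) (hi-greatest e<n He≡Hx)
    where
    He≡Hx : H e ≡ H x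
    He≡Hx = trans (cong ⌊_/2⌋ qe≡1+2Hx) (⌊1+2*/2⌋ (H x))
    e<hi-absurd : e < hi x → ⊥
    e<hi-absurd e<hi = <-irrefl refl (begin-strict
      q e                 <⟨ q-mono-< e<hi ⟩
      q (hi x)            ≤⟨ ≤1+2*⌊/2⌋ (q (hi x)) ⟩
      suc (2 * H (hi x))  ≡⟨ cong (suc ∘ (2 *_)) (H-hi x) ⟩
      suc (2 * H x)       ≡⟨ qe≡1+2Hx ⟨
      q e                 ∎)

  hi-gap : ∀ {x} → H (suc x) ≢ H x → hi x ≡ x
  hi-gap {x} Hsx≢Hx with suc x <? n
  ... | no  _ = refl
  ... | yes _ with H (suc x) ≟ H x
  ...   | yes Hsx≡Hx = ⊥-elim (Hsx≢Hx Hsx≡Hx)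
  ...   | no  _      = refl

  H-between : ∀ {s e y} → s ≤ e → H s ≤ H y → H y ≤ H e → ∃ λ b → s ≤ b × b ≤ e × H b ≡ H y
  H-between {s} {e} {y} s≤e Hs≤Hy Hy≤He with y <? s | e <? y
  ... | yes y<s | _       = s , ≤-refl , s≤e , ≤-antisym Hs≤Hy (H-mono (<⇒≤ y<s))
  ... | no  _   | yes e<y = e , s≤e , ≤-refl , ≤-antisym (H-mono (<⇒≤ e<y)) Hy≤He
  ... | no  y≮s | no  y≯e = y , ≮⇒≥ y≮s , ≮⇒≥ y≯e , refl

  pair-q : ∀ {a a'} → H a ≡ H a' → a < a' → q a ≡ 2 * H a × q a' ≡ suc (2 * H a)
  pair-q {a} {a'} Ha≡Ha' a<a' =
    ≤-antisym (≤-pred (≤-trans (q-mono-< a<a') qa'≤)) (2*⌊/2⌋≤ (q a)) ,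
    ≤-antisym qa'≤ (≤-trans (s≤s (2*⌊/2⌋≤ (q a))) (q-mono-< a<a'))
    where
    qa'≤ : q a' ≤ suc (2 * H a)
    qa'≤ = subst (λ h → q a' ≤ suc (2 * h)) (sym Ha≡Ha') (≤1+2*⌊/2⌋ (q a'))

  pair-sum-odd : ∀ {a a' b b' c} → a < a' → b' < b → H a ≡ H a' → H b' ≡ H b → q a + q b ≢ 2 * c
  pair-sum-odd {a} {a'} {b} {b'} {c} a<a' b'<b Ha≡Ha' Hb'≡Hb qa+qb≡2c = even≢odd c (H a + H b') (begin-equality
    2 * c                     ≡⟨ qa+qb≡2c ⟨
    q a + q b                 ≡⟨ cong₂ _+_ (proj₁ (pair-q Ha≡Ha' a<a')) (proj₂ (pair-q Hb'≡Hb b'<b)) ⟩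
    2 * H a + suc (2 * H b')  ≡⟨ +-suc (2 * H a) (2 * H b') ⟩
    suc (2 * H a + 2 * H b')  ≡⟨ cong suc (*-distribˡ-+ 2 (H a) (H b')) ⟨
    suc (2 * (H a + H b'))       ∎)

  -- Two different pairs a + b = a' + b' joining the same two blocks would run through two
  -- pair blocks in opposite directions, which makes q a + q b odd.
  mirror-sparse : ∀ {a a' b b' c c'} → a + b ≡ a' + b' → q a + q b ≡ 2 * c → q a' + q b' ≡ 2 * c' →
                  H a ≡ H a' → H b ≡ H b' → a ≡ a'
  mirror-sparse {a} {a'} {b} {b'} {c} {c'} sum≡ even even' Ha≡Ha' Hb≡Hb' with <-cmp a a'
  ... | tri≈ _ a≡a' _ = a≡a'
  ... | tri< a<a' _ _ =
    ⊥-elim (pair-sum-odd {c = c} a<a' (≰⇒> λ b≤b' → <-irrefl sum≡ (+-mono-<-≤ a<a' b≤b')) Ha≡Ha' (sym Hb≡Hb') even)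
  ... | tri> _ _ a'<a =
    ⊥-elim (pair-sum-odd {c = c'} a'<a (≰⇒> λ b'≤b → <-irrefl (sym sum≡) (+-mono-<-≤ a'<a b'≤b))
                          (sym Ha≡Ha') Hb≡Hb' even')

module BlockDiagonal (n : ℕ) (q : ℕ → ℕ) (q-strict : ∀ x → q x < q (suc x)) where
  open import Data.Nat using (ℕ; suc; _<_; _≟_)
  open import Data.Bool using (Bool; true; false)
  open import Data.Rational as ℚ using (ℚ; 0ℚ; 1ℚ)
  open import Data.Rational.Properties using (*-zeroˡ; *-zeroʳ; 1≢0)
  open import Data.Product using (_,_)
  open import Data.Sum using (inj₁; inj₂; [_,_]′)
  open import Data.Empty using (⊥-elim)
  open import Function using (_∘_; case_of_; _⇔_; mk⇔)
  open import Relation.Nullary using (Dec; yes; no)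
  open import Relation.Nullary.Decidable using (decidable-stable)
  open import Relation.Binary.PropositionalEquality
  open FinSum
  open SquareMatrix
  open TwoByTwo
  open BlockPartition n q q-strict

  first : ℕ → Bool
  first a with a ≟ lo a
  ... | yes _ = true
  ... | no  _ = false

  pick : ℕ → Bool → ℕ
  pick x true  = lo x
  pick x false = hi x

  blockDiag : Mat₂ → Mat
  blockDiag ρ a x with H a ≟ H x
  ... | no  _ = 0ℚ
  ... | yes _ with lo x ≟ hi x
  ...   | yes _ = 1ℚ
  ...   | no  _ = ρ (first a) (first x)

  module _ (ρ : Mat₂) where

    blockDiag-outside : ∀ {a x} → H a ≢ H x → blockDiag ρ a x ≡ 0ℚ
    blockDiag-outside {a} {x} Ha≢Hx with H a ≟ H x
    ... | yes Ha≡Hx = ⊥-elim (Ha≢Hx Ha≡Hx)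
    ... | no  _     = refl

    blockDiag-singleton : ∀ {a x} → H a ≡ H x → lo x ≡ hi x → blockDiag ρ a x ≡ 1ℚ
    blockDiag-singleton {a} {x} Ha≡Hx lo≡hi with H a ≟ H x
    ... | no  Ha≢Hx = ⊥-elim (Ha≢Hx Ha≡Hx)
    ... | yes _ with lo x ≟ hi x
    ...   | yes _    = refl
    ...   | no  lo≢hi = ⊥-elim (lo≢hi lo≡hi)

    blockDiag-pair : ∀ {a x} → H a ≡ H x → lo x ≢ hi x → blockDiag ρ a x ≡ ρ (first a) (first x)
    blockDiag-pair {a} {x} Ha≡Hx lo≢hi with H a ≟ H x
    ... | no  Ha≢Hx = ⊥-elim (Ha≢Hx Ha≡Hx)
    ... | yes _ with lo x ≟ hi x
    ...   | yes lo≡hi = ⊥-elim (lo≢hi lo≡hi)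
    ...   | no  _     = refl

  H-pick : ∀ x u → H (pick x u) ≡ H x
  H-pick x true  = H-lo x
  H-pick x false = H-hi x

  pick<n : ∀ {x} u → x < n → pick x u < n
  pick<n true  = lo<n
  pick<n false = hi<n

  first-pick : ∀ {x} u → x < n → lo x ≢ hi x → first (pick x u) ≡ u
  first-pick {x} true  _   _     with lo x ≟ lo (lo x)
  ... | yes _ = refl
  ... | no  lo≢lolo = ⊥-elim (lo≢lolo (sym (lo-cong (H-lo x))))
  first-pick {x} false x<n lo≢hi with hi x ≟ lo (hi x)
  ... | yes hi≡lohi = ⊥-elim (lo≢hi (sym (trans hi≡lohi (lo-cong (H-hi x)))))
  ... | no  _ = refl

  pick-first : ∀ {a x} → a < n → H a ≡ H x → lo x ≢ hi x → pick x (first a) ≡ a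
  pick-first {a} {x} a<n Ha≡Hx lo≢hi with a ≟ lo a | block-elements a<n Ha≡Hx
  ... | yes a≡loa | _         = sym (trans a≡loa (lo-cong Ha≡Hx))
  ... | no  a≢loa | inj₁ a≡lo = ⊥-elim (a≢loa (trans a≡lo (sym (lo-cong Ha≡Hx))))
  ... | no  _     | inj₂ a≡hi = sym a≡hi

  𝟙-pick : ∀ {x} u w → lo x ≢ hi x → 𝟙 (pick x u) (pick x w) ≡ δ₂ u w
  𝟙-pick {x} true  true  _     = 𝟙-diag (lo x)
  𝟙-pick {x} true  false lo≢hi = 𝟙-offdiag lo≢hi
  𝟙-pick {x} false true  lo≢hi = 𝟙-offdiag (lo≢hi ∘ sym)
  𝟙-pick {x} false false _     = 𝟙-diag (hi x)

  module _ (ρ : Mat₂) where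

    private
      B : Mat
      B = blockDiag ρ

    blockDiag-pick : ∀ {a x} u → x < n → H a ≡ H x → lo x ≢ hi x → B a (pick x u) ≡ ρ (first a) u
    blockDiag-pick {a} {x} u x<n Ha≡Hx lo≢hi =
      trans (blockDiag-pair ρ (trans Ha≡Hx (sym (H-pick x u))) pick-pair) (cong (ρ (first a)) (first-pick u x<n lo≢hi))
      where
      pick-pair : lo (pick x u) ≢ hi (pick x u)
      pick-pair rewrite lo-cong (H-pick x u) | hi-cong (pick<n u x<n) x<n (H-pick x u) = lo≢hi

    blockDiag-rows : RowOrthonormal₂ ρ → B ·[ n ] B ᵀ ≈[ n ] 𝟙
    blockDiag-rows orth a b a<n b<n with H a ≟ H b
    ... | no Ha≢Hb = trans (∑<-zero n (λ k _ → vanish k)) (sym (𝟙-offdiag (Ha≢Hb ∘ cong H)))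
      where
      vanish : ∀ k → B a k ℚ.* B b k ≡ 0ℚ
      vanish k = case H a ≟ H k of λ where
        (no  Ha≢Hk) → trans (cong (ℚ._* B b k) (blockDiag-outside ρ Ha≢Hk)) (*-zeroˡ (B b k))
        (yes Ha≡Hk) → trans (cong (B a k ℚ.*_) (blockDiag-outside ρ λ Hb≡Hk → Ha≢Hb (trans Ha≡Hk (sym Hb≡Hk))))
                            (*-zeroʳ (B a k))
    ... | yes Ha≡Hb with lo a ≟ hi a
    ...   | yes lo≡hi = begin
      ∑< n (λ k → B a k ℚ.* B b k)  ≡⟨ ∑<-single n (lo a) (lo<n a<n) vanish ⟩
      B a (lo a) ℚ.* B b (lo a)     ≡⟨ cong₂ ℚ._*_ (blockDiag-singleton ρ (sym (H-lo a)) lolo≡hilo)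
                                                   (blockDiag-singleton ρ (trans (sym Ha≡Hb) (sym (H-lo a))) lolo≡hilo) ⟩
      1ℚ
        ≡⟨ 𝟙-diag (lo a) ⟨
      𝟙 (lo a) (lo a)
        ≡⟨ cong₂ 𝟙 (sym (singleton-element a<n refl lo≡hi)) (sym (singleton-element b<n (sym Ha≡Hb) lo≡hi)) ⟩
      𝟙 a b ∎
      where
      open ≡-Reasoning
      lolo≡hilo : lo (lo a) ≡ hi (lo a)
      lolo≡hilo = trans (lo-cong (H-lo a)) (trans lo≡hi (sym (hi-cong (lo<n a<n) a<n (H-lo a))))
      vanish : ∀ k → k < n → k ≢ lo a → B a k ℚ.* B b k ≡ 0ℚ
      vanish k k<n k≢lo =
        trans (cong (ℚ._* B b k) (blockDiag-outside ρ (k≢lo ∘ λ Ha≡Hk → singleton-element k<n (sym Ha≡Hk) lo≡hi)))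
              (*-zeroˡ (B b k))
    ...   | no lo≢hi = begin
      ∑< n (λ k → B a k ℚ.* B b k)
        ≡⟨ ∑<-pair n (lo a) (hi a) (lo<n a<n) (hi<n a<n) lo≢hi vanish ⟩
      B a (pick a true) ℚ.* B b (pick a true) ℚ.+ B a (pick a false) ℚ.* B b (pick a false)
        ≡⟨ cong₂ ℚ._+_ (cong₂ ℚ._*_ (entry a true refl) (entry b true (sym Ha≡Hb)))
                       (cong₂ ℚ._*_ (entry a false refl) (entry b false (sym Ha≡Hb))) ⟩
      ρ (first a) true ℚ.* ρ (first b) true ℚ.+ ρ (first a) false ℚ.* ρ (first b) false
        ≡⟨ orth (first a) (first b) ⟩
      δ₂ (first a) (first b)
        ≡⟨ 𝟙-pick (first a) (first b) lo≢hi ⟨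
      𝟙 (pick a (first a)) (pick a (first b))
        ≡⟨ cong₂ 𝟙 (pick-first a<n refl lo≢hi) (pick-first b<n (sym Ha≡Hb) lo≢hi) ⟩
      𝟙 a b ∎
      where
      open ≡-Reasoning
      entry : ∀ c u → H c ≡ H a → B c (pick a u) ≡ ρ (first c) u
      entry c u Hc≡Ha = blockDiag-pick u a<n Hc≡Ha lo≢hi
      vanish : ∀ k → k < n → k ≢ lo a → k ≢ hi a → B a k ℚ.* B b k ≡ 0ℚ
      vanish k k<n k≢lo k≢hi = trans (cong (ℚ._* B b k) (blockDiag-outside ρ λ Ha≡Hk →
        [ k≢lo , k≢hi ]′ (block-elements k<n (sym Ha≡Hk)))) (*-zeroˡ (B b k))

  blockDiag-transpose : ∀ ρ {a x} → a < n → x < n → blockDiag ρ x a ≡ blockDiag (ρ ᵀ₂) a x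
  blockDiag-transpose ρ {a} {x} a<n x<n = by-block (H a ≟ H x)
    where
    by-block : Dec (H a ≡ H x) → blockDiag ρ x a ≡ blockDiag (ρ ᵀ₂) a x
    by-block (no Ha≢Hx) = trans (blockDiag-outside ρ (Ha≢Hx ∘ sym)) (sym (blockDiag-outside (ρ ᵀ₂) Ha≢Hx))
    by-block (yes Ha≡Hx) with lo x ≟ hi x
    ... | yes lo≡hi = trans (blockDiag-singleton ρ (sym Ha≡Hx) (trans (lo-cong Ha≡Hx) (trans lo≡hi (sym hia≡hix))))
                            (sym (blockDiag-singleton (ρ ᵀ₂) Ha≡Hx lo≡hi))
      where
      hia≡hix : hi a ≡ hi x
      hia≡hix = hi-cong a<n x<n Ha≡Hx
    ... | no lo≢hi =
      trans (blockDiag-pair ρ (sym Ha≡Hx) (λ loa≡hia → lo≢hi (trans (sym (lo-cong Ha≡Hx)) (trans loa≡hia hia≡hix))))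
                           (sym (blockDiag-pair (ρ ᵀ₂) Ha≡Hx lo≢hi))
      where
      hia≡hix : hi a ≡ hi x
      hia≡hix = hi-cong a<n x<n Ha≡Hx

  blockDiag-orthogonal : ∀ ρ → RowOrthonormal₂ ρ → RowOrthonormal₂ (ρ ᵀ₂) → Orthogonal n (blockDiag ρ)
  blockDiag-orthogonal ρ rows cols = blockDiag-rows ρ rows , λ a b a<n b<n →
    trans (∑<-cong n (λ k k<n → cong₂ ℚ._*_ (blockDiag-transpose ρ a<n k<n) (blockDiag-transpose ρ b<n k<n)))
          (blockDiag-rows (ρ ᵀ₂) cols a b a<n b<n)

  blockDiag-nonzero⇔ : ∀ ρ → NowhereZero₂ ρ → ∀ {a x} → blockDiag ρ a x ≢ 0ℚ ⇔ H a ≡ H x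
  blockDiag-nonzero⇔ ρ ρ≢0 {a} {x} = mk⇔
    (λ B≢0 → decidable-stable (H a ≟ H x) (B≢0 ∘ blockDiag-outside ρ))
    (λ Ha≡Hx → case lo x ≟ hi x of λ where
      (yes lo≡hi) → λ B≡0 → 1≢0 (trans (sym (blockDiag-singleton ρ Ha≡Hx lo≡hi)) B≡0)
      (no  lo≢hi) → ρ≢0 (first a) (first x) ∘ trans (sym (blockDiag-pair ρ Ha≡Hx lo≢hi)))

module ConjugatePattern (n : ℕ) (q : ℕ → ℕ) (q-strict : ∀ x → q x < q (suc x)) where
  open import Data.Nat using (ℕ; suc; _<_)
  open import Data.Rational as ℚ using (ℚ; 0ℚ; 1ℚ; NonZero; 1/_; ≢-nonZero)
  open import Data.Rational.Properties using (_≟_; *-zeroˡ; *-zeroʳ; *-identityˡ; *-assoc; *-inverseˡ)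
  open import Data.Product using (_×_; _,_; ∃₂; proj₁; proj₂)
  open import Function using (_∘_; _⇔_; mk⇔; Equivalence)
  open Equivalence using (to; from)
  open import Data.Empty using (⊥)
  open import Relation.Nullary.Decidable using (decidable-stable)
  open import Relation.Binary.PropositionalEquality
  open FinSum
  open SquareMatrix
  open TwoByTwo
  open BlockPartition n q q-strict
  open BlockDiagonal n q q-strict

  private
    *-≢0 : ∀ {x y} → x ≢ 0ℚ → y ≢ 0ℚ → x ℚ.* y ≢ 0ℚ
    *-≢0 {x} {y} x≢0 y≢0 xy≡0 = y≢0 (begin
      y                   ≡⟨ *-identityˡ y ⟨
      1ℚ ℚ.* y            ≡⟨ cong (ℚ._* y) (*-inverseˡ x) ⟨
      1/ x ℚ.* x ℚ.* y    ≡⟨ *-assoc (1/ x) x y ⟩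
      1/ x ℚ.* (x ℚ.* y)  ≡⟨ cong (1/ x ℚ.*_) xy≡0 ⟩
      1/ x ℚ.* 0ℚ         ≡⟨ *-zeroʳ (1/ x) ⟩
      0ℚ                  ∎)
      where
      open ≡-Reasoning
      instance x-nonZero : NonZero x
      x-nonZero = ≢-nonZero x≢0

    *-≢0ˡ : ∀ {x y} → x ℚ.* y ≢ 0ℚ → x ≢ 0ℚ
    *-≢0ˡ {x} {y} xy≢0 x≡0 = xy≢0 (trans (cong (ℚ._* y) x≡0) (*-zeroˡ y))

    *-≢0ʳ : ∀ {x y} → x ℚ.* y ≢ 0ℚ → y ≢ 0ℚ
    *-≢0ʳ {x} {y} xy≢0 y≡0 = xy≢0 (trans (cong (x ℚ.*_) y≡0) (*-zeroʳ x))

  Edge : Mat → ℕ → ℕ → Set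
  Edge K a b = a < n × b < n × K a b ≢ 0ℚ

  -- For block-sparse K every entry of Vᵀ K V is a sum with at most one nonzero term, so
  -- nothing cancels.
  BlockSparse : Mat → Set
  BlockSparse K = ∀ {a a' b b'} → Edge K a b → Edge K a' b' → H a ≡ H a' → H b ≡ H b' → a ≡ a' × b ≡ b'

  EdgeBetweenBlocks : Mat → ℕ → ℕ → Set
  EdgeBetweenBlocks K i j = ∃₂ λ a b → Edge K a b × H a ≡ H i × H b ≡ H j

  module _ (ρ : Mat₂) (ρ≢0 : NowhereZero₂ ρ) {K : Mat} (sparse : BlockSparse K) where

    private
      V : Mat
      V = blockDiag ρ
      V⇔ : ∀ {a x} → V a x ≢ 0ℚ ⇔ H a ≡ H x
      V⇔ = blockDiag-nonzero⇔ ρ ρ≢0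

    conj-nonzero⇔ : ∀ {i j} → conj n V K i j ≢ 0ℚ ⇔ EdgeBetweenBlocks K i j
    conj-nonzero⇔ {i} {j} = mk⇔ nonzero⇒edge edge⇒nonzero
      where
      term : ℕ → ℕ → ℚ
      term a b = V a i ℚ.* (K a b ℚ.* V b j)

      term-edge : ∀ {a b} → a < n → b < n → term a b ≢ 0ℚ → EdgeBetweenBlocks K i j
      term-edge {a} {b} a<n b<n t≢0 = a , b , (a<n , b<n , *-≢0ˡ KV≢0) , to V⇔ (*-≢0ˡ t≢0) , to V⇔ (*-≢0ʳ {K a b} KV≢0)
        where
        KV≢0 : K a b ℚ.* V b j ≢ 0ℚ
        KV≢0 = *-≢0ʳ {V a i} t≢0

      nonzero⇒edge : conj n V K i j ≢ 0ℚ → EdgeBetweenBlocks K i j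
      nonzero⇒edge Z≢0 with ∑<-nonzero⇒ n {λ a → ∑< n (term a)} (Z≢0 ∘ trans (conj-entry n V K i j))
      ... | a , a<n , row≢0 with ∑<-nonzero⇒ n {term a} row≢0
      ...   | b , b<n , t≢0 = term-edge a<n b<n t≢0

      edge⇒nonzero : EdgeBetweenBlocks K i j → conj n V K i j ≢ 0ℚ
      edge⇒nonzero (a₀ , b₀ , e₀@(a₀<n , b₀<n , K≢0) , Ha₀≡Hi , Hb₀≡Hj) Z≡0 = t₀≢0 (begin
        term a₀ b₀
          ≡⟨ ∑<-single n b₀ b₀<n (λ b b<n b≢b₀ → vanish a₀<n b<n (b≢b₀ ∘ proj₂)) ⟨
        ∑< n (term a₀)
          ≡⟨ ∑<-single n a₀ a₀<n (λ a a<n a≢a₀ → ∑<-zero n (λ b b<n → vanish a<n b<n (a≢a₀ ∘ proj₁))) ⟨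
        ∑< n (λ a → ∑< n (term a))
          ≡⟨ conj-entry n V K i j ⟨
        conj n V K i j
          ≡⟨ Z≡0 ⟩
        0ℚ ∎)
        where
        open ≡-Reasoning
        t₀≢0 : term a₀ b₀ ≢ 0ℚ
        t₀≢0 = *-≢0 (from V⇔ Ha₀≡Hi) (*-≢0 K≢0 (from V⇔ Hb₀≡Hj))
        vanish : ∀ {a b} → a < n → b < n → (a ≡ a₀ × b ≡ b₀ → ⊥) → term a b ≡ 0ℚ
        vanish a<n b<n not-edge₀ = decidable-stable (term _ _ ≟ 0ℚ) λ t≢0 →
          let (_ , _ , e , Ha≡Hi , Hb≡Hj) = term-edge a<n b<n t≢0
          in not-edge₀ (sparse e e₀ (trans Ha≡Hi (sym Ha₀≡Hi)) (trans Hb≡Hj (sym Hb₀≡Hj)))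

module MirrorBlocks (N : ℕ) (q : ℕ → ℕ) (q-strict : ∀ x → q x < q (suc x)) where
  open import Data.Nat using (ℕ; suc; _+_; _∸_; _<_; _≤_; s≤s)
  open import Data.Nat.Properties using (≤-trans; ∸-monoʳ-≤; m∸[m∸n]≡n; m∸n+n≡m; m+n∸m≡n; m≤m+n; m∸n≤m)
  open import Data.Product using (_×_; _,_; ∃₂; proj₁; proj₂)
  open import Function using (_⇔_; mk⇔; Equivalence)
  open Equivalence using (to; from)
  open import Relation.Binary.PropositionalEquality
  open BlockPartition (suc N) q q-strict

  MirrorEdge : ℕ → ℕ → Set
  MirrorEdge x y = ∃₂ λ a b → a + b ≡ N × H a ≡ H x × H b ≡ H y

  mirrorEdge⇔ : ∀ {x y} → x < suc N → MirrorEdge x y ⇔ (H (N ∸ hi x) ≤ H y × H y ≤ H (N ∸ lo x))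
  mirrorEdge⇔ {x} {y} x<n = mk⇔ edge⇒bounds bounds⇒edge
    where
    hi≤N : hi x ≤ N
    hi≤N with s≤s hi≤N′ ← hi<n x<n = hi≤N′
    lo≤N : lo x ≤ N
    lo≤N = ≤-trans (lo≤ x) (≤-trans (≤hi x) hi≤N)
    edge⇒bounds : MirrorEdge x y → H (N ∸ hi x) ≤ H y × H y ≤ H (N ∸ lo x)
    edge⇒bounds (a , b , a+b≡N , Ha≡Hx , Hb≡Hy) =
      subst (H (N ∸ hi x) ≤_) Hb≡Hy (H-mono (subst (N ∸ hi x ≤_) N∸a≡b (∸-monoʳ-≤ N a≤hi))) ,
      subst (_≤ H (N ∸ lo x)) Hb≡Hy (H-mono (subst (_≤ N ∸ lo x) N∸a≡b (∸-monoʳ-≤ N lo≤a)))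
      where
      N∸a≡b : N ∸ a ≡ b
      N∸a≡b = subst (λ m → m ∸ a ≡ b) a+b≡N (m+n∸m≡n a b)
      a<n : a < suc N
      a<n = s≤s (subst (a ≤_) a+b≡N (m≤m+n a b))
      lo≤a : lo x ≤ a
      lo≤a = proj₁ (to (sameBlock⇔ a<n) Ha≡Hx)
      a≤hi : a ≤ hi x
      a≤hi = proj₂ (to (sameBlock⇔ a<n) Ha≡Hx)
    bounds⇒edge : H (N ∸ hi x) ≤ H y × H y ≤ H (N ∸ lo x) → MirrorEdge x y
    bounds⇒edge (lower , upper) with H-between (∸-monoʳ-≤ N (≤-trans (lo≤ x) (≤hi x))) lower upper
    ... | b , N∸hi≤b , b≤N∸lo , Hb≡Hy = N ∸ b , b , m∸n+n≡m b≤N , Ha≡Hx , Hb≡Hy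
      where
      b≤N : b ≤ N
      b≤N = ≤-trans b≤N∸lo (m∸n≤m N (lo x))
      Ha≡Hx : H (N ∸ b) ≡ H x
      Ha≡Hx = from (sameBlock⇔ (s≤s (m∸n≤m N b)))
        ( subst (_≤ N ∸ b) (m∸[m∸n]≡n lo≤N) (∸-monoʳ-≤ N b≤N∸lo)
        , subst (N ∸ b ≤_) (m∸[m∸n]≡n hi≤N) (∸-monoʳ-≤ N N∸hi≤b))

module AntiDiagonal (N : ℕ) where
  open import Data.Nat using (ℕ; suc; _+_; _∸_; _<_; _≟_; s≤s)
  open import Data.Nat.Properties using (+-comm; +-cancelˡ-≡; m∸n≤m; m+[n∸m]≡n)
  open import Data.Rational as ℚ using (ℚ; 0ℚ; 1ℚ)
  open import Data.Rational.Properties using (*-identityˡ; *-zeroˡ; 1≢0)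
  open import Data.Empty using (⊥-elim)
  open import Function using (_∘_; _⇔_; mk⇔)
  open import Relation.Nullary using (Dec; yes; no)
  open import Relation.Binary.PropositionalEquality hiding (J)
  open FinSum
  open SquareMatrix

  private
    n : ℕ
    n = suc N

  sumsTo : ℕ → ℚ
  sumsTo s with s ≟ N
  ... | yes _ = 1ℚ
  ... | no  _ = 0ℚ

  J : Mat
  J a b = sumsTo (a + b)

  sumsTo-yes : ∀ {s} → s ≡ N → sumsTo s ≡ 1ℚ
  sumsTo-yes {s} s≡N with s ≟ N
  ... | yes _   = refl
  ... | no  s≢N = ⊥-elim (s≢N s≡N)

  sumsTo-no : ∀ {s} → s ≢ N → sumsTo s ≡ 0ℚ
  sumsTo-no {s} s≢N with s ≟ N
  ... | yes s≡N = ⊥-elim (s≢N s≡N)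
  ... | no  _   = refl

  J-nonzero⇔ : ∀ a b → J a b ≢ 0ℚ ⇔ a + b ≡ N
  J-nonzero⇔ a b = mk⇔
    (λ J≢0 → by-sum (a + b ≟ N) J≢0)
    (λ a+b≡N J≡0 → 1≢0 (trans (sym (sumsTo-yes a+b≡N)) J≡0))
    where
    by-sum : Dec (a + b ≡ N) → J a b ≢ 0ℚ → a + b ≡ N
    by-sum (yes a+b≡N) _   = a+b≡N
    by-sum (no  a+b≢N) J≢0 = ⊥-elim (J≢0 (sumsTo-no a+b≢N))

  J-symmetric : Symmetric J
  J-symmetric a b = cong sumsTo (+-comm a b)

  J-involutive : J ·[ n ] J ≈[ n ] 𝟙
  J-involutive a b (s≤s a≤N) _ = begin
    ∑< n (λ k → J a k ℚ.* J k b)  ≡⟨ ∑<-single n (N ∸ a) (s≤s (m∸n≤m N a)) vanish ⟩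
    J a a' ℚ.* J a' b             ≡⟨ cong (ℚ._* J a' b) (sumsTo-yes a+a'≡N) ⟩
    1ℚ ℚ.* J a' b                 ≡⟨ *-identityˡ (J a' b) ⟩
    sumsTo (a' + b)               ≡⟨ by-cases (a ≟ b) ⟩
    𝟙 a b                         ∎
    where
    open ≡-Reasoning
    a' : ℕ
    a' = N ∸ a
    a+a'≡N : a + a' ≡ N
    a+a'≡N = m+[n∸m]≡n a≤N
    vanish : ∀ k → k < n → k ≢ a' → J a k ℚ.* J k b ≡ 0ℚ
    vanish k _ k≢a' =
      trans (cong (ℚ._* J k b) (sumsTo-no (k≢a' ∘ λ a+k≡N → +-cancelˡ-≡ a k a' (trans a+k≡N (sym a+a'≡N)))))
            (*-zeroˡ (J k b))
    by-cases : Dec (a ≡ b) → sumsTo (a' + b) ≡ 𝟙 a b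
    by-cases (yes refl) = trans (sumsTo-yes (trans (+-comm a' a) a+a'≡N)) (sym (𝟙-diag a))
    by-cases (no  a≢b)  =
      trans (sumsTo-no (a≢b ∘ λ a'+b≡N → +-cancelˡ-≡ a' a b (trans (+-comm a' a) (trans a+a'≡N (sym a'+b≡N)))))
            (sym (𝟙-offdiag a≢b))

module TwistedAntiDiagonal
  (N c c' : ℕ) (c+c'≡N : c + c' ≡ N) (c≢c' : c ≢ c')
  (ρ : TwoByTwo.Mat₂) (ρ-symmetric : ∀ u w → ρ u w ≡ ρ w u) (ρ-rows : TwoByTwo.RowOrthonormal₂ ρ) where
  open import Data.Nat using (ℕ; suc; _+_; _<_; _≤_; _≟_; s≤s)
  open import Data.Nat.Properties using (+-comm; +-cancelˡ-≡; +-cancelʳ-≡; m≤m+n; m≤n+m)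
  open import Data.Bool using (Bool; true; false)
  open import Data.Maybe using (Maybe; just; nothing)
  open import Data.Rational as ℚ using (ℚ; 0ℚ)
  open import Data.Rational.Properties using (*-zeroˡ; *-zeroʳ)
  open import Data.Product using (_×_; _,_; ∃)
  open import Data.Sum using (_⊎_; inj₁; inj₂; [_,_]′)
  open import Data.Empty using (⊥-elim)
  open import Function using (_∘_; _⇔_; mk⇔; Equivalence)
  open import Relation.Nullary using (¬_; Dec; yes; no)
  open import Relation.Binary.PropositionalEquality hiding (J)
  open FinSum
  open SquareMatrix
  open TwoByTwo
  open AntiDiagonal N
  open Equivalence using (to; from)

  Twisted : ℕ → Set
  Twisted a = a ≡ c ⊎ a ≡ c'

  twisted? : ∀ a → Dec (Twisted a)
  twisted? a with a ≟ c | a ≟ c'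
  ... | yes a≡c | _       = yes (inj₁ a≡c)
  ... | no  _   | yes a≡c' = yes (inj₂ a≡c')
  ... | no  a≢c | no  a≢c' = no [ a≢c , a≢c' ]′

  point : Bool → ℕ
  point true  = c
  point false = c'

  position : ℕ → Maybe Bool
  position a with a ≟ c | a ≟ c'
  ... | yes _ | _     = just true
  ... | no  _ | yes _ = just false
  ... | no  _ | no  _ = nothing

  K : Mat
  K a b with position a | position b
  ... | just u | just w = ρ u w
  ... | _      | _      = J a b

  position-point : ∀ u → position (point u) ≡ just u
  position-point true with c ≟ c
  ... | yes _   = refl
  ... | no  c≢c = ⊥-elim (c≢c refl)
  position-point false with c' ≟ c | c' ≟ c'
  ... | yes c'≡c | _         = ⊥-elim (c≢c' (sym c'≡c))
  ... | no  _    | yes _     = refl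
  ... | no  _    | no  c'≢c' = ⊥-elim (c'≢c' refl)

  position-outside : ∀ {a} → ¬ Twisted a → position a ≡ nothing
  position-outside {a} a∉ with a ≟ c | a ≟ c'
  ... | yes a≡c | _        = ⊥-elim (a∉ (inj₁ a≡c))
  ... | no  _   | yes a≡c' = ⊥-elim (a∉ (inj₂ a≡c'))
  ... | no  _   | no  _    = refl

  point-twisted : ∀ u → Twisted (point u)
  point-twisted true  = inj₁ refl
  point-twisted false = inj₂ refl

  twisted-point : ∀ {a} → Twisted a → ∃ λ u → a ≡ point u
  twisted-point (inj₁ a≡c)  = true , a≡c
  twisted-point (inj₂ a≡c') = false , a≡c'

  K-point : ∀ u w → K (point u) (point w) ≡ ρ u w
  K-point u w rewrite position-point u | position-point w = refl

  K-outsideˡ : ∀ {a} b → ¬ Twisted a → K a b ≡ J a b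
  K-outsideˡ {a} b a∉ rewrite position-outside a∉ = refl

  K-outsideʳ : ∀ a {b} → ¬ Twisted b → K a b ≡ J a b
  K-outsideʳ a {b} b∉ with position a
  ... | nothing = refl
  ... | just _ rewrite position-outside b∉ = refl

  mirror-twisted : ∀ {a b} → a + b ≡ N → Twisted a → Twisted b
  mirror-twisted a+b≡N (inj₁ refl) = inj₂ (+-cancelˡ-≡ c _ c' (trans a+b≡N (sym c+c'≡N)))
  mirror-twisted a+b≡N (inj₂ refl) = inj₁ (+-cancelʳ-≡ c' _ c (trans (+-comm _ c') (trans a+b≡N (sym c+c'≡N))))

  K-symmetric : Symmetric K
  K-symmetric a b with twisted? a | twisted? b
  ... | yes a∈ | yes b∈ with twisted-point a∈ | twisted-point b∈
  ...   | u , refl | w , refl = trans (K-point u w) (trans (ρ-symmetric u w) (sym (K-point w u)))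
  K-symmetric a b | no a∉ | _ = trans (K-outsideˡ b a∉) (trans (J-symmetric a b) (sym (K-outsideʳ b a∉)))
  K-symmetric a b | yes _ | no b∉ = trans (K-outsideʳ a b∉) (trans (J-symmetric a b) (sym (K-outsideˡ a b∉)))

  𝟙-point : ∀ u w → 𝟙 (point u) (point w) ≡ δ₂ u w
  𝟙-point true  true  = 𝟙-diag c
  𝟙-point true  false = 𝟙-offdiag c≢c'
  𝟙-point false true  = 𝟙-offdiag (c≢c' ∘ sym)
  𝟙-point false false = 𝟙-diag c'

  J-mirror-vanish : ∀ {a k} → Twisted a → ¬ Twisted k → J a k ≡ 0ℚ
  J-mirror-vanish {a} {k} a∈ k∉ = by-sum (a + k ≟ N)
    where
    by-sum : Dec (a + k ≡ N) → J a k ≡ 0ℚ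
    by-sum (yes a+k≡N) = ⊥-elim (k∉ (mirror-twisted a+k≡N a∈))
    by-sum (no  a+k≢N) = sumsTo-no a+k≢N

  K-involutive : K ·[ suc N ] K ≈[ suc N ] 𝟙
  K-involutive a b a<n b<n with twisted? a
  ... | no a∉ = trans (∑<-cong (suc N) (λ k _ → outside-row k)) (J-involutive a b a<n b<n)
    where
    outside-row : ∀ k → K a k ℚ.* K k b ≡ J a k ℚ.* J k b
    outside-row k with twisted? k
    ... | no  k∉ = cong₂ ℚ._*_ (K-outsideˡ k a∉) (K-outsideˡ b k∉)
    ... | yes k∈ = begin
      K a k ℚ.* K k b  ≡⟨ cong (ℚ._* K k b) (trans (K-outsideˡ k a∉) Jak≡0) ⟩
      0ℚ ℚ.* K k b     ≡⟨ *-zeroˡ (K k b) ⟩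
      0ℚ               ≡⟨ *-zeroˡ (J k b) ⟨
      0ℚ ℚ.* J k b     ≡⟨ cong (ℚ._* J k b) Jak≡0 ⟨
      J a k ℚ.* J k b  ∎
      where
      open ≡-Reasoning
      Jak≡0 : J a k ≡ 0ℚ
      Jak≡0 = trans (J-symmetric a k) (J-mirror-vanish k∈ a∉)
  ... | yes a∈ with twisted-point a∈
  ...   | u , refl = trans (∑<-pair (suc N) c c' c<n c'<n c≢c' vanish) (by-column (twisted? b))
    where
    c<n : c < suc N
    c<n = s≤s (subst (c ≤_) c+c'≡N (m≤m+n c c'))
    c'<n : c' < suc N
    c'<n = s≤s (subst (c' ≤_) c+c'≡N (m≤n+m c' c))
    vanish : ∀ k → k < suc N → k ≢ c → k ≢ c' → K (point u) k ℚ.* K k b ≡ 0ℚ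
    vanish k _ k≢c k≢c' = trans (cong (ℚ._* K k b) (trans (K-outsideʳ (point u) k∉) (J-mirror-vanish (point-twisted u) k∉)))
                                (*-zeroˡ (K k b))
      where
      k∉ : ¬ Twisted k
      k∉ = [ k≢c , k≢c' ]′
    by-column : Dec (Twisted b) → K (point u) c ℚ.* K c b ℚ.+ K (point u) c' ℚ.* K c' b ≡ 𝟙 (point u) b
    by-column (yes b∈) with twisted-point b∈
    ... | w , refl = begin
      K (point u) (point true) ℚ.* K (point true) (point w) ℚ.+ K (point u) (point false) ℚ.* K (point false) (point w)
        ≡⟨ cong₂ ℚ._+_ (cong₂ ℚ._*_ (K-point u true) (trans (K-point true w) (ρ-symmetric true w)))
                       (cong₂ ℚ._*_ (K-point u false) (trans (K-point false w) (ρ-symmetric false w))) ⟩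
      ρ u true ℚ.* ρ w true ℚ.+ ρ u false ℚ.* ρ w false
        ≡⟨ ρ-rows u w ⟩
      δ₂ u w
        ≡⟨ 𝟙-point u w ⟨
      𝟙 (point u) (point w) ∎
      where open ≡-Reasoning
    by-column (no b∉) = begin
      K (point u) c ℚ.* K c b ℚ.+ K (point u) c' ℚ.* K c' b
        ≡⟨ cong₂ ℚ._+_ (cong (K (point u) c ℚ.*_) (trans (K-outsideʳ c b∉) (J-mirror-vanish (inj₁ refl) b∉)))
                       (cong (K (point u) c' ℚ.*_) (trans (K-outsideʳ c' b∉) (J-mirror-vanish (inj₂ refl) b∉))) ⟩
      K (point u) c ℚ.* 0ℚ ℚ.+ K (point u) c' ℚ.* 0ℚ
        ≡⟨ cong₂ ℚ._+_ (*-zeroʳ (K (point u) c)) (*-zeroʳ (K (point u) c')) ⟩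
      0ℚ
        ≡⟨ 𝟙-offdiag (λ u≡b → b∉ (subst Twisted u≡b (point-twisted u))) ⟨
      𝟙 (point u) b ∎
      where open ≡-Reasoning

  K-nonzero⇔ : NowhereZero₂ ρ → ∀ a b → K a b ≢ 0ℚ ⇔ (a + b ≡ N ⊎ Twisted a × Twisted b)
  K-nonzero⇔ ρ≢0 a b = mk⇔ nonzero⇒ ⇒nonzero
    where
    nonzero⇒ : K a b ≢ 0ℚ → a + b ≡ N ⊎ Twisted a × Twisted b
    nonzero⇒ K≢0 with twisted? a | twisted? b
    ... | yes a∈ | yes b∈ = inj₂ (a∈ , b∈)
    ... | no  a∉ | _      = inj₁ (to (J-nonzero⇔ a b) (K≢0 ∘ trans (K-outsideˡ b a∉)))
    ... | yes _  | no b∉  = inj₁ (to (J-nonzero⇔ a b) (K≢0 ∘ trans (K-outsideʳ a b∉)))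
    both-twisted : Twisted a → Twisted b → K a b ≢ 0ℚ
    both-twisted a∈ b∈ with twisted-point a∈ | twisted-point b∈
    ... | u , refl | w , refl = ρ≢0 u w ∘ trans (sym (K-point u w))
    ⇒nonzero : a + b ≡ N ⊎ Twisted a × Twisted b → K a b ≢ 0ℚ
    ⇒nonzero (inj₂ (a∈ , b∈)) = both-twisted a∈ b∈
    ⇒nonzero (inj₁ a+b≡N) with twisted? a
    ... | yes a∈ = both-twisted a∈ (mirror-twisted a+b≡N a∈)
    ... | no  a∉ = from (J-nonzero⇔ a b) a+b≡N ∘ trans (sym (K-outsideˡ b a∉))

module OddCase (m : ℕ) where
  open import Data.Nat using (ℕ; suc; _+_; _*_; _∸_; _/_; _<_; _≤_; _≤ᵇ_; z≤n; s≤s; ⌊_/2⌋)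
  open import Data.Nat.Properties
  open import Data.Bool using (true; _∧_)
  open import Data.Product using (_×_; _,_; ∃; proj₁; proj₂)
  open import Data.Sum using (_⊎_; inj₁; inj₂)
  open import Function using (_∘_; id; _⇔_; mk⇔; Equivalence)
  open import Relation.Nullary using (yes; no)
  open import Function.Properties.Equivalence using (⇔-setoid) renaming (sym to ⇔-sym)
  open import Level using (0ℓ)
  open import Relation.Binary.PropositionalEquality hiding (J)
  open import Data.Rational using (0ℚ)
  open import Data.Nat.Tactic.RingSolver using (solve-∀)
  open import Data.Fin.Properties using (toℕ<n)
  open Basics
  open SquareMatrix
  open TwoByTwo
  open Equivalence using (to; from)

  N n : ℕ
  N = 2 * m
  n = suc N

  -- With q = id the blocks are {2k, 2k + 1} and the singleton {2m}.
  open BlockPartition n id n<1+n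
  open BlockDiagonal n id n<1+n
  open ConjugatePattern n id n<1+n
  open MirrorBlocks N id n<1+n
  open AntiDiagonal N

  Z : Mat
  Z = conj n (blockDiag rotation) J

  Z-symmetric : Symmetric Z
  Z-symmetric = conj-symmetric n (blockDiag rotation) J-symmetric

  Z-involutive : Z ·[ n ] Z ≈[ n ] 𝟙
  Z-involutive = conj-involutive n {blockDiag rotation} {J}
                   (blockDiag-orthogonal rotation rotation-rows rotation-columns) J-involutive

  J-sparse : BlockSparse J
  J-sparse {a} {a'} {b} {b'} (_ , _ , Jab≢0) (_ , _ , Ja'b'≢0) Ha≡Ha' Hb≡Hb' =
    a≡a' , +-cancelˡ-≡ a b b' (trans a+b≡N (trans (sym a'+b'≡N) (cong (_+ b') (sym a≡a'))))
    where
    a+b≡N : a + b ≡ N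
    a+b≡N = to (J-nonzero⇔ a b) Jab≢0
    a'+b'≡N : a' + b' ≡ N
    a'+b'≡N = to (J-nonzero⇔ a' b') Ja'b'≢0
    a≡a' : a ≡ a'
    a≡a' = mirror-sparse {c = m} {c' = m} (trans a+b≡N (sym a'+b'≡N)) a+b≡N a'+b'≡N Ha≡Ha' Hb≡Hb'

  Z-nonzero⇔ : ∀ {x y} → x < n → Z x y ≢ 0ℚ ⇔ (H (N ∸ hi x) ≤ H y × H y ≤ H (N ∸ lo x))
  Z-nonzero⇔ {x} {y} x<n = begin
    Z x y ≢ 0ℚ                                       ≈⟨ conj-nonzero⇔ rotation rotation-nowhereZero J-sparse ⟩
    EdgeBetweenBlocks J x y                          ≈⟨ mk⇔ edge⇒mirror mirror⇒edge ⟩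
    MirrorEdge x y                                   ≈⟨ mirrorEdge⇔ x<n ⟩
    (H (N ∸ hi x) ≤ H y × H y ≤ H (N ∸ lo x))       ∎
    where
    open import Relation.Binary.Reasoning.Setoid (⇔-setoid 0ℓ)
    edge⇒mirror : EdgeBetweenBlocks J x y → MirrorEdge x y
    edge⇒mirror (a , b , (_ , _ , Jab≢0) , Ha≡Hx , Hb≡Hy) = a , b , to (J-nonzero⇔ a b) Jab≢0 , Ha≡Hx , Hb≡Hy
    mirror⇒edge : MirrorEdge x y → EdgeBetweenBlocks J x y
    mirror⇒edge (a , b , a+b≡N , Ha≡Hx , Hb≡Hy) =
      a , b , (s≤s (subst (a ≤_) a+b≡N (m≤m+n a b)) , s≤s (subst (b ≤_) a+b≡N (m≤n+m b a)) ,
               from (J-nonzero⇔ a b) a+b≡N) ,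
      Ha≡Hx , Hb≡Hy

  zigzag-row⇔ : ∀ {s y t} → 2 ≤ s → s / 2 ≡ suc t → y < n →
                zigzagS n s (suc y) ≡ true ⇔ (t ≤ ⌊ y /2⌋ × ⌊ y /2⌋ ≤ suc t)
  zigzag-row⇔ {suc (suc s)} {y} {t} _ s/2≡t+1 y<n rewrite s/2≡t+1 = mk⇔
    (λ row → let (lower , rest) = to ∧⇔× row in to lower-bound lower , to upper-bound (proj₁ (to ∧⇔× rest)))
    (λ (t≤ , ≤t+1) → from ∧⇔× (from lower-bound t≤ , from ∧⇔× (from upper-bound ≤t+1 , from ≤ᵇ⇔≤ y<n)))
    where
    lower-bound : (2 * suc t ∸ 1 ≤ᵇ suc y) ≡ true ⇔ t ≤ ⌊ y /2⌋
    lower-bound = mk⇔ (to 2*≤⇔≤⌊/2⌋ ∘ ≤-pred ∘ subst (_≤ suc y) bound≡ ∘ to ≤ᵇ⇔≤)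
                      (from ≤ᵇ⇔≤ ∘ subst (_≤ suc y) (sym bound≡) ∘ s≤s ∘ from 2*≤⇔≤⌊/2⌋)
      where
      bound≡ : 2 * suc t ∸ 1 ≡ suc (2 * t)
      bound≡ = cong (_∸ 1) (2*-suc t)
    upper-bound : (suc y ≤ᵇ 2 * suc t + 2) ≡ true ⇔ ⌊ y /2⌋ ≤ suc t
    upper-bound = mk⇔ (from ⌊/2⌋≤⇔≤1+2* ∘ ≤-pred ∘ subst (suc y ≤_) bound≡ ∘ to ≤ᵇ⇔≤)
                      (from ≤ᵇ⇔≤ ∘ subst (suc y ≤_) (sym bound≡) ∘ s≤s ∘ to ⌊/2⌋≤⇔≤1+2*)
      where
      bound≡ : 2 * suc t + 2 ≡ suc (suc (2 * suc t))
      bound≡ = +-comm (2 * suc t) 2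

  zigzag-first-row⇔ : ∀ {y} → zigzagS n 1 (suc y) ≡ true ⇔ (0 ≤ ⌊ y /2⌋ × ⌊ y /2⌋ ≤ 0)
  zigzag-first-row⇔ = mk⇔ (λ row → z≤n , from ⌊/2⌋≤⇔≤1+2* (≤-pred (to ≤ᵇ⇔≤ (proj₂ (to ∧⇔× row)))))
                          (λ (_ , ≤0) → from ∧⇔× (refl , from ≤ᵇ⇔≤ (s≤s (to ⌊/2⌋≤⇔≤1+2* ≤0))))

  record MirroredRow (x : ℕ) : Set where
    field
      t         : ℕ
      H-start   : H (N ∸ hi x) ≡ t
      H-end     : H (N ∸ lo x) ≡ suc t
      2≤n∸x    : 2 ≤ n ∸ x
      n∸x/2    : (n ∸ x) / 2 ≡ suc t

  interior-row : ∀ {x} → x < N → MirroredRow x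
  interior-row {x} x<N = record { t = t ; H-start = H-start ; H-end = H-end ; 2≤n∸x = 2≤n∸x ; n∸x/2 = n∸x/2 }
    where
    k t : ℕ
    k = H x
    t = m ∸ suc k
    k<m : k < m
    k<m = *-cancelˡ-< 2 k m (≤-<-trans (2*⌊/2⌋≤ x) x<N)
    m≡ : suc k + t ≡ m
    m≡ = m+[n∸m]≡n k<m
    N≡hi+ : N ≡ suc (2 * k) + suc (2 * t)
    N≡hi+ = trans (cong (2 *_) (sym m≡)) (ring k t)
      where
      ring : ∀ k t → 2 * (suc k + t) ≡ suc (2 * k) + suc (2 * t)
      ring = solve-∀
    N≡lo+ : N ≡ 2 * k + 2 * suc t
    N≡lo+ = trans (cong (2 *_) (sym m≡)) (ring k t)
      where
      ring : ∀ k t → 2 * (suc k + t) ≡ 2 * k + 2 * suc t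
      ring = solve-∀
    H-start : H (N ∸ hi x) ≡ t
    H-start = begin
      H (N ∸ hi x)
        ≡⟨ cong (λ e → H (N ∸ e)) (hi-of-odd (s≤s (≤-trans (s≤s (2*⌊/2⌋≤ x)) x<N)) refl) ⟩
      H (N ∸ suc (2 * k))
        ≡⟨ cong (λ N → H (N ∸ suc (2 * k))) N≡hi+ ⟩
      H (suc (2 * k) + suc (2 * t) ∸ suc (2 * k))
        ≡⟨ cong H (m+n∸m≡n (suc (2 * k)) _) ⟩
      ⌊ suc (2 * t) /2⌋
        ≡⟨ ⌊1+2*/2⌋ t ⟩
      t ∎
      where open ≡-Reasoning
    H-end : H (N ∸ lo x) ≡ suc t
    H-end = begin
      H (N ∸ lo x)                                      ≡⟨ cong (λ s → H (N ∸ s)) (lo-of-even {x = x} refl) ⟩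
      H (N ∸ 2 * k)                                     ≡⟨ cong (λ N → H (N ∸ 2 * k)) N≡lo+ ⟩
      H (2 * k + 2 * suc t ∸ 2 * k)                     ≡⟨ cong H (m+n∸m≡n (2 * k) _) ⟩
      ⌊ 2 * suc t /2⌋                                   ≡⟨ ⌊2*/2⌋ (suc t) ⟩
      suc t                                             ∎
      where open ≡-Reasoning
    n∸x≡ : n ∸ x ≡ 2 * suc t ⊎ n ∸ x ≡ suc (2 * suc t)
    n∸x≡ with parity x
    ... | inj₁ x≡2k   = inj₂ (begin
      suc N ∸ x                             ≡⟨ cong₂ (λ N x → suc N ∸ x) N≡lo+ x≡2k ⟩
      suc (2 * k + 2 * suc t) ∸ 2 * k       ≡⟨ cong (_∸ 2 * k) (+-suc (2 * k) (2 * suc t)) ⟨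
      2 * k + suc (2 * suc t) ∸ 2 * k       ≡⟨ m+n∸m≡n (2 * k) _ ⟩
      suc (2 * suc t)                       ∎)
      where open ≡-Reasoning
    ... | inj₂ x≡2k+1 = inj₁ (begin
      suc N ∸ x                             ≡⟨ cong₂ (λ N x → suc N ∸ x) N≡lo+ x≡2k+1 ⟩
      2 * k + 2 * suc t ∸ 2 * k             ≡⟨ m+n∸m≡n (2 * k) _ ⟩
      2 * suc t                             ∎)
      where open ≡-Reasoning
    2≤n∸x : 2 ≤ n ∸ x
    2≤n∸x with n∸x≡
    ... | inj₁ eq = subst (2 ≤_) (sym (trans eq (2*-suc t))) (s≤s (s≤s z≤n))
    ... | inj₂ eq = subst (2 ≤_) (sym (trans eq (cong suc (2*-suc t)))) (s≤s (s≤s z≤n))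
    n∸x/2 : (n ∸ x) / 2 ≡ suc t
    n∸x/2 with n∸x≡
    ... | inj₁ eq = trans (/2≡⌊/2⌋ (n ∸ x)) (trans (cong ⌊_/2⌋ eq) (⌊2*/2⌋ (suc t)))
    ... | inj₂ eq = trans (/2≡⌊/2⌋ (n ∸ x)) (trans (cong ⌊_/2⌋ eq) (⌊1+2*/2⌋ (suc t)))

  last-row-ends : lo N ≡ N × hi N ≡ N
  last-row-ends = lo-of-even {x = N} (cong (2 *_) (sym (⌊2*/2⌋ m))) , ≤-antisym (≤-pred (hi<n {N} ≤-refl)) (≤hi N)

  bounds-cong : ∀ {s e s' e' y} → H s ≡ s' → H e ≡ e' → (H s ≤ H y × H y ≤ H e) ⇔ (s' ≤ H y × H y ≤ e')
  bounds-cong refl refl = mk⇔ id id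

  Z-pattern : ∀ {x y} → x < n → y < n → Z x y ≢ 0ℚ ⇔ zigzagS n (n ∸ x) (suc y) ≡ true
  Z-pattern {x} {y} x<n y<n with x <? N
  ... | yes x<N = begin
    Z x y ≢ 0ℚ                                  ≈⟨ Z-nonzero⇔ x<n ⟩
    (H (N ∸ hi x) ≤ H y × H y ≤ H (N ∸ lo x))  ≈⟨ bounds-cong H-start H-end ⟩
    (t ≤ H y × H y ≤ suc t)                     ≈⟨ ⇔-sym (zigzag-row⇔ 2≤n∸x n∸x/2 y<n) ⟩
    zigzagS n (n ∸ x) (suc y) ≡ true            ∎
    where
    open import Relation.Binary.Reasoning.Setoid (⇔-setoid 0ℓ)
    open MirroredRow (interior-row x<N)
  ... | no x≮N with ≤-antisym (≤-pred x<n) (≮⇒≥ x≮N)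
  ...   | refl = begin
    Z N y ≢ 0ℚ
      ≈⟨ Z-nonzero⇔ x<n ⟩
    (H (N ∸ hi N) ≤ H y × H y ≤ H (N ∸ lo N))
      ≈⟨ bounds-cong (H-N∸ (proj₂ last-row-ends)) (H-N∸ (proj₁ last-row-ends)) ⟩
    (0 ≤ H y × H y ≤ 0)
      ≈⟨ ⇔-sym zigzag-first-row⇔ ⟩
    zigzagS n 1 (suc y) ≡ true
      ≡⟨ cong (λ s → zigzagS n s (suc y) ≡ true) (m+n∸n≡m 1 N) ⟨
    zigzagS n (n ∸ N) (suc y) ≡ true ∎
    where
    open import Relation.Binary.Reasoning.Setoid (⇔-setoid 0ℓ)
    H-N∸ : ∀ {e} → e ≡ N → H (N ∸ e) ≡ 0
    H-N∸ refl = cong H (n∸n≡0 N)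

  oddWitness : ∃ λ (Y : Matrix n) → IsSymmetric Y × IsOrthogonal Y × HasZeroPattern Y (Λ n)
  oddWitness = toMatrix n Z , toMatrix-symmetric n {Z} Z-symmetric ,
               toMatrix-orthogonal n {Z} (symmetric-involution⇒orthogonal n Z-symmetric Z-involutive) ,
               λ i j → Z-pattern (toℕ<n i) (toℕ<n j)

module EvenCase (c : ℕ) (0<c : 0 < c) where
  open import Data.Nat using (ℕ; zero; suc; pred; _+_; _*_; _∸_; _/_; _<_; _≤_; _≤?_; z≤n; s≤s; ⌊_/2⌋; >-nonZero)
  open import Data.Nat.Properties
  open import Data.Bool using (true)
  open import Data.Product using (_×_; _,_; ∃; proj₁; proj₂)
  open import Data.Sum using (_⊎_; inj₁; inj₂; [_,_]′)
  open import Relation.Binary using (tri<; tri≈; tri>)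
  open import Data.Empty using (⊥; ⊥-elim)
  open import Data.Rational using (0ℚ)
  open import Function using (_∘_; id; _⇔_; mk⇔; Equivalence)
  open import Function.Properties.Equivalence using (⇔-setoid) renaming (sym to ⇔-sym; refl to ⇔-refl; trans to ⇔-trans)
  open import Data.Sum.Function.Propositional using (_⊎-⇔_)
  open import Level using (0ℓ)
  open import Relation.Nullary using (¬_; Dec; yes; no)
  open import Relation.Binary.PropositionalEquality hiding (J)
  open import Data.Nat.Tactic.RingSolver using (solve-∀)
  open Basics
  open Offsets
  open import Data.Fin.Properties using (toℕ<n)
  import Data.Integer as ℤ
  open import Data.Product.Function.NonDependent.Propositional using (_×-⇔_)
  open SquareMatrix
  open TwoByTwo
  open Equivalence using (to; from)

  -- N is pred n so that suc N reduces to n = 2 * m.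
  m n N : ℕ
  m = suc c
  n = 2 * m
  N = pred n

  N≡c+m : N ≡ c + m
  N≡c+m = cong (c +_) (+-identityʳ m)

  -- q skips the value 2m + 1: the blocks are …, {m - 4, m - 3}, {m - 2, m - 1}, {m},
  -- {m + 1, m + 2}, …, and K twists the pair {c, m} = {m - 1, m} by a reflection.
  q : ℕ → ℕ
  q y with y ≤? m
  ... | yes _ = y + m
  ... | no  _ = suc (y + m)

  q-low : ∀ {y} → y ≤ m → q y ≡ y + m
  q-low {y} y≤m with y ≤? m
  ... | yes _   = refl
  ... | no  y≰m = ⊥-elim (y≰m y≤m)

  q-high : ∀ {y} → m < y → q y ≡ suc (y + m)
  q-high {y} m<y with y ≤? m
  ... | yes y≤m = ⊥-elim (<⇒≱ m<y y≤m)
  ... | no  _   = refl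

  q-strict : ∀ y → q y < q (suc y)
  q-strict y = by-cases (suc y ≤? m)
    where
    q-≤ : q y ≤ suc (y + m)
    q-≤ with y ≤? m
    ... | yes _ = n≤1+n _
    ... | no  _ = ≤-refl
    by-cases : Dec (suc y ≤ m) → q y < q (suc y)
    by-cases (yes y<m) = subst₂ _<_ (sym (q-low (<⇒≤ y<m))) (sym (q-low y<m)) ≤-refl
    by-cases (no  y≮m) = subst (q y <_) (sym (q-high (≰⇒> y≮m))) (s≤s q-≤)

  open BlockPartition n q q-strict
  open BlockDiagonal n q q-strict
  open ConjugatePattern n q q-strict
  open MirrorBlocks N q q-strict
  open AntiDiagonal N
  open TwistedAntiDiagonal N c m (sym N≡c+m) (<⇒≢ (n<1+n c)) reflection reflection-symmetric reflection-rows

  Z : Mat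
  Z = conj n (blockDiag rotation) K

  Z-symmetric : Symmetric Z
  Z-symmetric = conj-symmetric n (blockDiag rotation) K-symmetric

  Z-involutive : Z ·[ n ] Z ≈[ n ] 𝟙
  Z-involutive = conj-involutive n {blockDiag rotation} {K}
                   (blockDiag-orthogonal rotation rotation-rows rotation-columns) K-involutive

  2m≡m+m : 2 * m ≡ m + m
  2m≡m+m = cong (m +_) (+-identityʳ m)

  c+m≡1+2c : c + m ≡ suc (2 * c)
  c+m≡1+2c = trans (+-suc c c) (cong (suc ∘ (c +_)) (sym (+-identityʳ c)))

  H-c : H c ≡ c
  H-c = trans (cong ⌊_/2⌋ (trans (q-low (n≤1+n c)) c+m≡1+2c)) (⌊1+2*/2⌋ c)

  H-m : H m ≡ m
  H-m = trans (cong ⌊_/2⌋ (trans (q-low ≤-refl) (sym 2m≡m+m))) (⌊2*/2⌋ m)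

  H-1+m : H (suc m) ≡ suc m
  H-1+m = trans (cong ⌊_/2⌋ (trans (q-high ≤-refl) (trans (cong (suc ∘ suc) (sym 2m≡m+m)) (sym (2*-suc m)))))
                (⌊2*/2⌋ (suc m))

  m<n : m < n
  m<n = m<m+n m (s≤s z≤n)

  c<n : c < n
  c<n = <-trans (n<1+n c) m<n

  1+pred-c : suc (pred c) ≡ c
  1+pred-c = suc-pred c {{>-nonZero 0<c}}

  lo-c : lo c ≡ pred c
  lo-c = lo-of-even {x = c} (begin
    q (pred c)         ≡⟨ q-low (≤-trans pred[n]≤n (n≤1+n c)) ⟩
    pred c + suc c     ≡⟨ +-suc (pred c) c ⟩
    suc (pred c) + c   ≡⟨ cong (_+ c) 1+pred-c ⟩
    c + c              ≡⟨ cong (c +_) (+-identityʳ c) ⟨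
    2 * c              ≡⟨ cong (2 *_) H-c ⟨
    2 * H c            ∎)
    where open ≡-Reasoning

  hi-c : hi c ≡ c
  hi-c = hi-of-odd c<n (trans (trans (q-low (n≤1+n c)) c+m≡1+2c) (cong (suc ∘ (2 *_)) (sym H-c)))

  block-of-c : ∀ {a} → a < n → H a ≡ c → a ≡ c ⊎ suc a ≡ c
  block-of-c a<n Ha≡c with block-elements a<n (trans Ha≡c (sym H-c))
  ... | inj₁ a≡lo = inj₂ (trans (cong suc (trans a≡lo lo-c)) 1+pred-c)
  ... | inj₂ a≡hi = inj₁ (trans a≡hi hi-c)

  lo-m : lo m ≡ m
  lo-m = lo-of-even {x = m} (trans (q-low ≤-refl) (trans (sym 2m≡m+m) (cong (2 *_) (sym H-m))))

  hi-m : hi m ≡ m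
  hi-m = hi-gap (λ H1+m≡Hm → 1+n≢n (trans (sym H-1+m) (trans H1+m≡Hm H-m)))

  block-of-m : ∀ {a} → a < n → H a ≡ m → a ≡ m
  block-of-m a<n Ha≡m with block-elements a<n (trans Ha≡m (sym H-m))
  ... | inj₁ a≡lo = trans a≡lo lo-m
  ... | inj₂ a≡hi = trans a≡hi hi-m

  twisted-H : ∀ {a} → Twisted a → H a ≡ c ⊎ H a ≡ m
  twisted-H (inj₁ refl) = inj₁ H-c
  twisted-H (inj₂ refl) = inj₂ H-m

  twisted-H-injective : ∀ {a a'} → Twisted a → Twisted a' → H a ≡ H a' → a ≡ a'
  twisted-H-injective (inj₁ refl) (inj₁ refl) _     = refl
  twisted-H-injective (inj₂ refl) (inj₂ refl) _     = refl
  twisted-H-injective (inj₁ refl) (inj₂ refl) Hc≡Hm = ⊥-elim (<-irrefl (trans (sym H-c) (trans Hc≡Hm H-m)) (n<1+n c))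
  twisted-H-injective (inj₂ refl) (inj₁ refl) Hm≡Hc = ⊥-elim (<-irrefl (trans (sym H-c) (trans (sym Hm≡Hc) H-m)) (n<1+n c))

  mirror-q-sum : ∀ {a b} → a + b ≡ N → ¬ Twisted a → q a + q b ≡ 2 * (2 * m)
  mirror-q-sum {a} {b} a+b≡N a∉ = begin
    q a + q b                  ≡⟨ by-side (a ≤? m) ⟩
    suc (a + b + (m + m))      ≡⟨ cong (λ s → suc (s + (m + m))) a+b≡c+m ⟩
    suc (c + m + (m + m))      ≡⟨ ring c ⟩
    2 * (2 * m)                ∎
    where
    open ≡-Reasoning
    a+b≡c+m : a + b ≡ c + m
    a+b≡c+m = trans a+b≡N N≡c+m
    ring : ∀ c → suc (c + suc c + (suc c + suc c)) ≡ 2 * (2 * suc c)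
    ring = solve-∀
    low-high : ∀ a b m → a + m + suc (b + m) ≡ suc (a + b + (m + m))
    low-high = solve-∀
    high-low : ∀ a b m → suc (a + m) + (b + m) ≡ suc (a + b + (m + m))
    high-low = solve-∀
    by-side : Dec (a ≤ m) → q a + q b ≡ suc (a + b + (m + m))
    by-side (yes a≤m) = trans (cong₂ _+_ (q-low a≤m) (q-high m<b)) (low-high a b m)
      where
      a<c : a < c
      a<c = ≤∧≢⇒< (≤-pred (≤∧≢⇒< a≤m (a∉ ∘ inj₂))) (a∉ ∘ inj₁)
      m<b : m < b
      m<b = ≰⇒> λ b≤m → <-irrefl a+b≡c+m (+-mono-<-≤ a<c b≤m)
    by-side (no a≰m) = trans (cong₂ _+_ (q-high (≰⇒> a≰m)) (q-low b≤m)) (high-low a b m)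
      where
      b≤m : b ≤ m
      b≤m = ≮⇒≥ λ m<b → <-irrefl (sym a+b≡c+m) (+-mono-< (<-trans (n<1+n c) (≰⇒> a≰m)) m<b)

  edge-kind : ∀ {a b} → Edge K a b → (a + b ≡ N × ¬ Twisted a) ⊎ (Twisted a × Twisted b)
  edge-kind {a} {b} (_ , _ , K≢0) with to (K-nonzero⇔ reflection-nowhereZero a b) K≢0 | twisted? a
  ... | inj₂ both      | _      = inj₂ both
  ... | inj₁ a+b≡N     | yes a∈ = inj₂ (a∈ , mirror-twisted a+b≡N a∈)
  ... | inj₁ a+b≡N     | no  a∉ = inj₁ (a+b≡N , a∉)

  twisted-H≤m : ∀ {a} → Twisted a → H a ≤ m
  twisted-H≤m (inj₁ refl) = ≤-trans (≤-reflexive H-c) (n≤1+n c)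
  twisted-H≤m (inj₂ refl) = ≤-reflexive H-m

  twisted-blocks-closed : ∀ {a b a' b'} → Twisted a → Twisted b → a' < n → a' + b' ≡ N → ¬ Twisted a' →
                          H a ≡ H a' → H b ≡ H b' → ⊥
  twisted-blocks-closed {a} {b} {a'} {b'} a∈ b∈ a'<n a'+b'≡N a'∉ Ha≡Ha' Hb≡Hb' with twisted-H a∈
  ... | inj₂ Ha≡m = a'∉ (inj₂ (block-of-m a'<n (trans (sym Ha≡Ha') Ha≡m)))
  ... | inj₁ Ha≡c with block-of-c a'<n (trans (sym Ha≡Ha') Ha≡c)
  ...   | inj₁ a'≡c  = a'∉ (inj₁ a'≡c)
  ...   | inj₂ 1+a'≡c = 1+n≰n (subst (_≤ m) (trans Hb≡Hb' (trans (cong H b'≡1+m) H-1+m)) (twisted-H≤m b∈))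
    where
    b'≡1+m : b' ≡ suc m
    b'≡1+m = +-cancelˡ-≡ a' b' (suc m) (trans a'+b'≡N (trans N≡c+m (trans (cong (_+ m) (sym 1+a'≡c)) (sym (+-suc a' m)))))

  K-sparse : BlockSparse K
  K-sparse {a} {a'} {b} {b'} e@(a<n , _) e'@(a'<n , _) Ha≡Ha' Hb≡Hb' with edge-kind e | edge-kind e'
  ... | inj₁ (a+b≡N , a∉) | inj₁ (a'+b'≡N , a'∉) =
    a≡a' , +-cancelˡ-≡ a b b' (trans a+b≡N (trans (sym a'+b'≡N) (cong (_+ b') (sym a≡a'))))
    where
    a≡a' : a ≡ a'
    a≡a' = mirror-sparse {c = 2 * m} {c' = 2 * m} (trans a+b≡N (sym a'+b'≡N))
                         (mirror-q-sum a+b≡N a∉) (mirror-q-sum a'+b'≡N a'∉) Ha≡Ha' Hb≡Hb'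
  ... | inj₂ (a∈ , b∈) | inj₂ (a'∈ , b'∈) = twisted-H-injective a∈ a'∈ Ha≡Ha' , twisted-H-injective b∈ b'∈ Hb≡Hb'
  ... | inj₂ (a∈ , b∈) | inj₁ (a'+b'≡N , a'∉) =
    ⊥-elim (twisted-blocks-closed a∈ b∈ a'<n a'+b'≡N a'∉ Ha≡Ha' Hb≡Hb')
  ... | inj₁ (a+b≡N , a∉) | inj₂ (a'∈ , b'∈) =
    ⊥-elim (twisted-blocks-closed a'∈ b'∈ a<n a+b≡N a∉ (sym Ha≡Ha') (sym Hb≡Hb'))

  TwistedBlock : ℕ → Set
  TwistedBlock x = c ≤ H x × H x ≤ m

  twisted-TwistedBlock : ∀ {a x} → Twisted a → H a ≡ H x → TwistedBlock x
  twisted-TwistedBlock a∈ Ha≡Hx with twisted-H a∈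
  ... | inj₁ Ha≡c = subst (λ h → c ≤ h × h ≤ m) (trans (sym Ha≡c) Ha≡Hx) (≤-refl , n≤1+n c)
  ... | inj₂ Ha≡m = subst (λ h → c ≤ h × h ≤ m) (trans (sym Ha≡m) Ha≡Hx) (n≤1+n c , ≤-refl)

  TwistedBlock-witness : ∀ {x} → TwistedBlock x → ∃ λ a → Twisted a × H a ≡ H x
  TwistedBlock-witness {x} (c≤Hx , Hx≤m) with m≤n⇒m<n∨m≡n c≤Hx
  ... | inj₂ c≡Hx = c , inj₁ refl , trans H-c c≡Hx
  ... | inj₁ c<Hx = m , inj₂ refl , trans H-m (≤-antisym c<Hx Hx≤m)

  edge⇔ : ∀ {x y} → EdgeBetweenBlocks K x y ⇔ (MirrorEdge x y ⊎ (TwistedBlock x × TwistedBlock y))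
  edge⇔ {x} {y} = mk⇔ edge⇒ ⇒edge
    where
    edge⇒ : EdgeBetweenBlocks K x y → MirrorEdge x y ⊎ (TwistedBlock x × TwistedBlock y)
    edge⇒ (a , b , e , Ha≡Hx , Hb≡Hy) with edge-kind e
    ... | inj₁ (a+b≡N , _) = inj₁ (a , b , a+b≡N , Ha≡Hx , Hb≡Hy)
    ... | inj₂ (a∈ , b∈)   = inj₂ (twisted-TwistedBlock {x = x} a∈ Ha≡Hx , twisted-TwistedBlock {x = y} b∈ Hb≡Hy)
    ⇒edge : MirrorEdge x y ⊎ (TwistedBlock x × TwistedBlock y) → EdgeBetweenBlocks K x y
    ⇒edge (inj₁ (a , b , a+b≡N , Ha≡Hx , Hb≡Hy)) =
      a , b , (s≤s (subst (a ≤_) a+b≡N (m≤m+n a b)) , s≤s (subst (b ≤_) a+b≡N (m≤n+m b a)) ,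
               from (K-nonzero⇔ reflection-nowhereZero a b) (inj₁ a+b≡N)) ,
      Ha≡Hx , Hb≡Hy
    ⇒edge (inj₂ (bx , by)) with TwistedBlock-witness {x} bx | TwistedBlock-witness {y} by
    ... | a , a∈ , Ha≡Hx | b , b∈ , Hb≡Hy =
      a , b , (twisted<n a∈ , twisted<n b∈ , from (K-nonzero⇔ reflection-nowhereZero a b) (inj₂ (a∈ , b∈))) , Ha≡Hx , Hb≡Hy
      where
      twisted<n : ∀ {a} → Twisted a → a < n
      twisted<n (inj₁ refl) = c<n
      twisted<n (inj₂ refl) = m<n

  MirrorBounds : ℕ → ℕ → Set
  MirrorBounds x y = H (N ∸ hi x) ≤ H y × H y ≤ H (N ∸ lo x)

  Z-nonzero⇔ : ∀ {x y} → x < n → Z x y ≢ 0ℚ ⇔ (MirrorBounds x y ⊎ (TwistedBlock x × TwistedBlock y))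
  Z-nonzero⇔ {x} {y} x<n = begin
    Z x y ≢ 0ℚ
      ≈⟨ conj-nonzero⇔ rotation rotation-nowhereZero K-sparse {x} {y} ⟩
    EdgeBetweenBlocks K x y
      ≈⟨ edge⇔ {x} {y} ⟩
    (MirrorEdge x y ⊎ (TwistedBlock x × TwistedBlock y))
      ≈⟨ mirrorEdge⇔ {x} {y} x<n ⊎-⇔ ⇔-refl ⟩
    (MirrorBounds x y ⊎ (TwistedBlock x × TwistedBlock y)) ∎
    where open import Relation.Binary.Reasoning.Setoid (⇔-setoid 0ℓ)

  private
    y+m≤2m : ∀ {y} → y ≤ m → y + m ≤ 2 * m
    y+m≤2m {y} y≤m = subst (y + m ≤_) (sym 2m≡m+m) (+-monoˡ-≤ m y≤m)

    2m<y+m : ∀ {y} → m < y → 2 * m < y + m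
    2m<y+m {y} m<y = subst (_< y + m) (sym 2m≡m+m) (+-monoˡ-< m m<y)

  H≤-low : ∀ {y h} → suc (2 * h) ≤ 2 * m → H y ≤ h ⇔ y + m ≤ suc (2 * h)
  H≤-low {y} {h} 1+2h≤2m = ⇔-trans ⌊/2⌋≤⇔≤1+2* (by-side (y ≤? m))
    where
    by-side : Dec (y ≤ m) → (q y ≤ suc (2 * h)) ⇔ (y + m ≤ suc (2 * h))
    by-side (yes y≤m) rewrite q-low y≤m = ⇔-refl
    by-side (no  y≰m) rewrite q-high (≰⇒> y≰m) = mk⇔ (⊥-elim ∘ too-big ∘ ≤-trans (n≤1+n _)) (⊥-elim ∘ too-big)
      where
      too-big : y + m ≤ suc (2 * h) → ⊥
      too-big le = 1+n≰n (≤-trans (+-monoˡ-< m (≰⇒> y≰m)) (≤-trans le (subst (suc (2 * h) ≤_) 2m≡m+m 1+2h≤2m)))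

  H≤-high : ∀ {y h} → m ≤ h → H y ≤ h ⇔ y + m ≤ 2 * h
  H≤-high {y} {h} m≤h = ⇔-trans ⌊/2⌋≤⇔≤1+2* (by-side (y ≤? m))
    where
    by-side : Dec (y ≤ m) → (q y ≤ suc (2 * h)) ⇔ (y + m ≤ 2 * h)
    by-side (yes y≤m) rewrite q-low y≤m = both (≤-trans y+m≤2h (n≤1+n _)) y+m≤2h
      where
      y+m≤2h : y + m ≤ 2 * h
      y+m≤2h = ≤-trans (y+m≤2m y≤m) (*-monoʳ-≤ 2 m≤h)
    by-side (no  y≰m) rewrite q-high (≰⇒> y≰m) = mk⇔ ≤-pred s≤s

  ≤H-low : ∀ {y h} → h ≤ m → h ≤ H y ⇔ 2 * h ≤ y + m
  ≤H-low {y} {h} h≤m = ⇔-trans (⇔-sym 2*≤⇔≤⌊/2⌋) (by-side (y ≤? m))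
    where
    by-side : Dec (y ≤ m) → (2 * h ≤ q y) ⇔ (2 * h ≤ y + m)
    by-side (yes y≤m) rewrite q-low y≤m = ⇔-refl
    by-side (no  y≰m) rewrite q-high (≰⇒> y≰m) = both (≤-trans 2h≤y+m (n≤1+n _)) 2h≤y+m
      where
      2h≤y+m : 2 * h ≤ y + m
      2h≤y+m = ≤-trans (*-monoʳ-≤ 2 h≤m) (<⇒≤ (2m<y+m (≰⇒> y≰m)))

  ≤H-high : ∀ {y h} → suc m ≤ h → h ≤ H y ⇔ 2 * h ≤ suc (y + m)
  ≤H-high {y} {h} m<h = ⇔-trans (⇔-sym 2*≤⇔≤⌊/2⌋) (by-side (y ≤? m))
    where
    2m+2≤2h : suc (suc (2 * m)) ≤ 2 * h
    2m+2≤2h = subst (_≤ 2 * h) (2*-suc m) (*-monoʳ-≤ 2 m<h)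
    by-side : Dec (y ≤ m) → (2 * h ≤ q y) ⇔ (2 * h ≤ suc (y + m))
    by-side (yes y≤m) rewrite q-low y≤m =
      neither (λ le → 1+n≰n (≤-trans (≤-trans 2m+2≤2h le) (≤-trans (y+m≤2m y≤m) (n≤1+n _))))
              (λ le → 1+n≰n (≤-trans 2m+2≤2h (≤-trans le (s≤s (y+m≤2m y≤m)))))
    by-side (no  y≰m) rewrite q-high (≰⇒> y≰m) = ⇔-refl

  Sharp : ℕ → ℕ → Set
  Sharp x y = sharpEntry (offset m x) (offset m y) ≡ true

  private
    column-- : ∀ K₁ K₂ {y} →
               inRange (ℤ.- ℤ.+ K₁) (ℤ.- ℤ.+ K₂) (offset m y) ≡ true ⇔ (m ≤ suc y + K₁ × suc y + K₂ ≤ m)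
    column-- K₁ K₂ {y} = ⇔-trans inRange⇔ (-K≤difference⇔ K₁ (suc y) m ×-⇔ difference≤-K⇔ K₂ (suc y) m)

    column++ : ∀ K₁ K₂ {y} →
               inRange (ℤ.+ K₁) (ℤ.+ K₂) (offset m y) ≡ true ⇔ (K₁ + m ≤ suc y × suc y ≤ K₂ + m)
    column++ K₁ K₂ {y} = ⇔-trans inRange⇔ (+K≤difference⇔ K₁ (suc y) m ×-⇔ difference≤+K⇔ K₂ (suc y) m)

    column-+ : ∀ K₁ K₂ {y} →
               inRange (ℤ.- ℤ.+ K₁) (ℤ.+ K₂) (offset m y) ≡ true ⇔ (m ≤ suc y + K₁ × suc y ≤ K₂ + m)
    column-+ K₁ K₂ {y} = ⇔-trans inRange⇔ (-K≤difference⇔ K₁ (suc y) m ×-⇔ difference≤+K⇔ K₂ (suc y) m)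

  offset-above : ∀ d → offset m (suc m + d) ≡ ℤ.+ suc (suc d)
  offset-above d = trans (cong (λ k → ℤ.+ k ℤ.- ℤ.+ m) (sym (trans (+-suc m (suc d)) (cong suc (+-suc m d)))))
                         (difference-+ m (suc (suc d)))

  sharp-above : ∀ d {y} → Sharp (suc m + d) y ⇔ (m ≤ suc y + (2 * suc ⌊ d /2⌋ + 1) × suc y + 2 * ⌊ d /2⌋ ≤ m)
  sharp-above d {y} =
    ⇔-trans (≡⇒⇔ (cong (λ r → sharpEntry r (offset m y) ≡ true) (offset-above d)))
            (⇔-trans (column-- _ _) (≡⇒⇔ (cong₂ (λ K₁ K₂ → m ≤ suc y + K₁ × suc y + K₂ ≤ m) lower upper)))
    where
    half : suc (suc d) / 2 ≡ suc ⌊ d /2⌋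
    half = /2≡⌊/2⌋ (suc (suc d))
    lower : 2 * (suc (suc d) / 2) + 1 ≡ 2 * suc ⌊ d /2⌋ + 1
    lower = cong (λ k → 2 * k + 1) half
    upper : 2 * (suc (suc d) / 2) ∸ 2 ≡ 2 * ⌊ d /2⌋
    upper = trans (cong (λ k → 2 * k ∸ 2) half) (cong (_∸ 2) (2*-suc ⌊ d /2⌋))

  not-twisted-above : ∀ {x} → m < x → ¬ TwistedBlock x
  not-twisted-above {x} m<x (_ , Hx≤m) = 1+n≰n (≤-trans (subst (_≤ H x) H-1+m (H-mono m<x)) Hx≤m)

  -- Row x = m + 1 + d: with j = ⌊d/2⌋ and c = 2j + 1 + w, both rows are the interval
  -- w - 2 ≤ y ≤ w + 1.
  module AboveRow (d : ℕ) (x<n : suc m + d < n) where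

    x j : ℕ
    x = suc m + d
    j = ⌊ d /2⌋

    H-x : H x ≡ suc m + j
    H-x = trans (cong ⌊_/2⌋ (trans (q-high (s≤s (m≤m+n m d))) (ring m d))) (⌊2*+/2⌋ (suc m) d)
      where
      ring : ∀ m d → suc (suc m + d + m) ≡ 2 * suc m + d
      ring = solve-∀

    2j+1≤c : suc (2 * j) ≤ c
    2j+1≤c = ≤-pred (+-cancelˡ-≤ m _ _ (subst₂ _≤_ (ring m j) 2m≡m+m
               (≤-trans (s≤s (s≤s (+-monoʳ-≤ m (2*⌊/2⌋≤ d)))) x<n)))
      where
      ring : ∀ m j → suc (suc m + 2 * j) ≡ m + suc (suc (2 * j))
      ring = solve-∀

    w : ℕ
    w = c ∸ suc (2 * j)

    m≡ : m ≡ suc (suc (2 * j) + w)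
    m≡ = cong suc (sym (m+[n∸m]≡n 2j+1≤c))

    lo-x : lo x ≡ suc m + 2 * j
    lo-x = lo-of-even {x = x} (trans (q-high (s≤s (m≤m+n m (2 * j)))) (trans (ring m j) (cong (2 *_) (sym H-x))))
      where
      ring : ∀ m j → suc (suc m + 2 * j + m) ≡ 2 * (suc m + j)
      ring = solve-∀

    N≡ : N ≡ suc m + 2 * j + w
    N≡ = trans N≡c+m (trans (cong (_+ m) (sym (m+[n∸m]≡n 2j+1≤c))) (ring (2 * j) w m))
      where
      ring : ∀ a w m → suc a + w + m ≡ suc m + a + w
      ring = solve-∀

    H-w : H w ≡ suc (j + w)
    H-w = trans (cong ⌊_/2⌋ (trans (q-low w≤m) (trans (cong (w +_) m≡) (ring j w)))) (⌊2*/2⌋ (suc (j + w)))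
      where
      w≤m : w ≤ m
      w≤m = ≤-trans (m∸n≤m c (suc (2 * j))) (n≤1+n c)
      ring : ∀ j w → w + suc (suc (2 * j) + w) ≡ 2 * suc (j + w)
      ring = solve-∀

    upper⇔ : ∀ {y} → H y ≤ H (N ∸ lo x) ⇔ y ≤ suc w
    upper⇔ {y} = begin
      H y ≤ H (N ∸ lo x)
        ≡⟨ cong (λ l → H y ≤ H (N ∸ l)) lo-x ⟩
      H y ≤ H (N ∸ (suc m + 2 * j))
        ≡⟨ cong (λ e → H y ≤ H e) (trans (cong (_∸ (suc m + 2 * j)) N≡) (m+n∸m≡n (suc m + 2 * j) w)) ⟩
      H y ≤ H w
        ≡⟨ cong (H y ≤_) H-w ⟩
      H y ≤ suc (j + w)
        ≈⟨ H≤-low (subst (λ k → suc (2 * suc (j + w)) ≤ 2 * k) (sym m≡) (fits j w)) ⟩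
      y + m ≤ suc (2 * suc (j + w))
        ≈⟨ cancel⇔ (suc (suc (2 * j + w))) (trans (cong (y +_) m≡) (ring₁ y j w)) (ring₂ j w) ⟩
      y ≤ suc w ∎
      where
      open import Relation.Binary.Reasoning.Setoid (⇔-setoid 0ℓ)
      fits : ∀ j w → suc (2 * suc (j + w)) ≤ 2 * suc (suc (2 * j) + w)
      fits j w = subst (suc (2 * suc (j + w)) ≤_) (ring j w) (m≤m+n _ _)
        where
        ring : ∀ j w → suc (2 * suc (j + w)) + suc (2 * j) ≡ 2 * suc (suc (2 * j) + w)
        ring = solve-∀
      ring₁ : ∀ y j w → y + suc (suc (2 * j) + w) ≡ y + suc (suc (2 * j + w))
      ring₁ = solve-∀
      ring₂ : ∀ j w → suc (2 * suc (j + w)) ≡ suc w + suc (suc (2 * j + w))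
      ring₂ = solve-∀

    lower⇔ : ∀ {y} → H (N ∸ hi x) ≤ H y ⇔ w ≤ suc (suc y)
    lower⇔ {y} = by-w w refl
      where
      open import Relation.Binary.Reasoning.Setoid (⇔-setoid 0ℓ)
      by-w : ∀ v → w ≡ v → H (N ∸ hi x) ≤ H y ⇔ v ≤ suc (suc y)
      by-w zero w≡0 = both (subst (λ e → H e ≤ H y) (sym N∸hi≡0) (H-mono {0} {y} z≤n)) z≤n
        where
        lo≡N : lo x ≡ N
        lo≡N = trans lo-x (sym (trans N≡ (trans (cong (suc m + 2 * j +_) w≡0) (+-identityʳ _))))
        N∸hi≡0 : N ∸ hi x ≡ 0
        N∸hi≡0 = m≤n⇒m∸n≡0 (subst (_≤ hi x) lo≡N (≤-trans (lo≤ x) (≤hi x)))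
      by-w (suc w') w≡1+w' = begin
        H (N ∸ hi x) ≤ H y
          ≡⟨ cong (λ e → H e ≤ H y) N∸hi≡w' ⟩
        H w' ≤ H y
          ≡⟨ cong (_≤ H y) H-w' ⟩
        suc (j + w') ≤ H y
          ≈⟨ ≤H-low j+w'<m ⟩
        2 * suc (j + w') ≤ y + m
          ≈⟨ cancel⇔ (suc (2 * j + w')) (ring₁ j w') (trans (cong (y +_) m≡′) (ring₂ y j w')) ⟩
        suc w' ≤ suc (suc y) ∎
        where
        m≡′ : m ≡ suc (suc (2 * j) + suc w')
        m≡′ = trans m≡ (cong (λ v → suc (suc (2 * j) + v)) w≡1+w')
        hi-x : hi x ≡ suc (suc m + 2 * j)
        hi-x = hi-of-odd {x = x}
          (subst (λ k → suc (suc k + 2 * j) < 2 * k) (sym m≡′) (≤-trans (m≤m+n _ w') (≤-reflexive (ring′ j w'))))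
          (trans (q-high (s≤s (≤-trans (m≤m+n m (2 * j)) (n≤1+n _)))) (trans (ring m j) (cong (suc ∘ (2 *_)) (sym H-x))))
          where
          ring : ∀ m j → suc (suc (suc m + 2 * j) + m) ≡ suc (2 * (suc m + j))
          ring = solve-∀
          ring′ : ∀ j w' → let k = suc (suc (2 * j) + suc w') in suc (suc (suc k + 2 * j)) + w' ≡ 2 * k
          ring′ = solve-∀
        N∸hi≡w' : N ∸ hi x ≡ w'
        N∸hi≡w' = trans (cong₂ _∸_ (trans N≡ (trans (cong (suc m + 2 * j +_) w≡1+w') (+-suc (suc m + 2 * j) w'))) hi-x)
                        (m+n∸m≡n (suc (suc m + 2 * j)) w')
        H-w' : H w' ≡ suc (j + w')
        H-w' = trans (cong ⌊_/2⌋ (trans (q-low w'≤m) (trans (cong (w' +_) m≡′) (ring j w')))) (⌊1+2*/2⌋ (suc (j + w')))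
          where
          w'≤m : w' ≤ m
          w'≤m = subst (w' ≤_) (sym (trans m≡′ (ring′ j w'))) (m≤m+n w' _)
            where
            ring′ : ∀ j w' → suc (suc (2 * j) + suc w') ≡ w' + suc (suc (suc (2 * j)))
            ring′ = solve-∀
          ring : ∀ j w' → w' + suc (suc (2 * j) + suc w') ≡ suc (2 * suc (j + w'))
          ring = solve-∀
        j+w'<m : suc (j + w') ≤ m
        j+w'<m = subst (suc (j + w') ≤_) (sym (trans m≡′ (ring j w'))) (m≤m+n _ _)
          where
          ring : ∀ j w' → suc (suc (2 * j) + suc w') ≡ suc (j + w') + suc (suc j)
          ring = solve-∀
        ring₁ : ∀ j w' → 2 * suc (j + w') ≡ suc w' + suc (2 * j + w')
        ring₁ = solve-∀
        ring₂ : ∀ y j w' → y + suc (suc (2 * j) + suc w') ≡ suc (suc y) + suc (2 * j + w')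
        ring₂ = solve-∀

    sharp⇔ : ∀ {y} → Sharp x y ⇔ (w ≤ suc (suc y) × y ≤ suc w)
    sharp⇔ {y} = ⇔-trans (sharp-above d)
      (cancel⇔ (suc (suc (2 * j))) (trans m≡ (ring₁ j w)) (ring₂ y j) ×-⇔
       cancel⇔ (suc (2 * j)) (sym (+-suc y (2 * j))) (trans m≡ (ring₃ j w)))
      where
      ring₁ : ∀ j w → suc (suc (2 * j) + w) ≡ w + suc (suc (2 * j))
      ring₁ = solve-∀
      ring₂ : ∀ y j → suc y + (2 * suc j + 1) ≡ suc (suc y) + suc (suc (2 * j))
      ring₂ = solve-∀
      ring₃ : ∀ j w → suc (suc (2 * j) + w) ≡ suc w + suc (2 * j)
      ring₃ = solve-∀

    row⇔ : ∀ {y} → Z x y ≢ 0ℚ ⇔ Sharp x y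
    row⇔ {y} = begin
      Z x y ≢ 0ℚ
        ≈⟨ Z-nonzero⇔ x<n ⟩
      (MirrorBounds x y ⊎ (TwistedBlock x × TwistedBlock y))
        ≈⟨ mk⇔ [ id , ⊥-elim ∘ not-twisted-above m<x ∘ proj₁ ]′ inj₁ ⟩
      MirrorBounds x y
        ≈⟨ lower⇔ ×-⇔ upper⇔ ⟩
      (w ≤ suc (suc y) × y ≤ suc w)
        ≈⟨ ⇔-sym sharp⇔ ⟩
      Sharp x y ∎
      where
      open import Relation.Binary.Reasoning.Setoid (⇔-setoid 0ℓ)
      m<x : m < x
      m<x = s≤s (m≤m+n m d)

  sharp-below : ∀ s {x y} → m ≡ suc x + suc (suc s) →
                Sharp x y ⇔ (2 * suc ⌊ s /2⌋ + m ≤ suc y × suc y ≤ 2 * suc ⌊ s /2⌋ + 3 + m)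
  sharp-below s {x} {y} m≡ =
    ⇔-trans (≡⇒⇔ (cong (λ r → sharpEntry r (offset m y) ≡ true) offset-below))
            (⇔-trans (column++ _ _) (≡⇒⇔ (cong (λ K → K + m ≤ suc y × suc y ≤ K + 3 + m) (cong (2 *_) half))))
    where
    half : suc (suc s) / 2 ≡ suc ⌊ s /2⌋
    half = /2≡⌊/2⌋ (suc (suc s))
    offset-below : offset m x ≡ ℤ.-[1+ suc s ]
    offset-below = trans (cong (λ k → ℤ.+ suc x ℤ.- ℤ.+ k) m≡) (difference-- (suc x) (suc s))

  not-twisted-below : ∀ {x} → suc (H x) ≤ c → ¬ TwistedBlock x
  not-twisted-below Hx<c (c≤Hx , _) = 1+n≰n (≤-trans Hx<c c≤Hx)

  -- Rows x of the block whose last element is e, where m = e + 2i + 3: both rows are the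
  -- interval m + 2i + 1 ≤ y ≤ m + 2i + 4.
  module BelowBlock (i e : ℕ) (m≡ : m ≡ e + suc (suc (suc (2 * i)))) (x : ℕ) (x≤e : x ≤ e) (H-x : H x ≡ suc (e + i)) where

    c≡ : c ≡ e + suc (suc (2 * i))
    c≡ = suc-injective (trans m≡ (+-suc e _))

    hi-x : hi x ≡ e
    hi-x = hi-of-odd (≤-<-trans e≤m m<n)
                     (trans (q-low e≤m) (trans (cong (e +_) m≡) (trans (ring e i) (cong (suc ∘ (2 *_)) (sym H-x)))))
      where
      e≤m : e ≤ m
      e≤m = subst (e ≤_) (sym m≡) (m≤m+n e _)
      ring : ∀ e i → e + (e + suc (suc (suc (2 * i)))) ≡ suc (2 * suc (e + i))
      ring = solve-∀

    N≡ : N ≡ e + suc (suc (m + 2 * i))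
    N≡ = trans N≡c+m (trans (cong (_+ m) c≡) (ring e i m))
      where
      ring : ∀ e i m → e + suc (suc (2 * i)) + m ≡ e + suc (suc (m + 2 * i))
      ring = solve-∀

    lower⇔ : ∀ {y} → H (N ∸ hi x) ≤ H y ⇔ suc (m + 2 * i) ≤ y
    lower⇔ {y} = begin
      H (N ∸ hi x) ≤ H y                       ≡⟨ cong (λ k → H k ≤ H y) N∸hi ⟩
      H (suc (suc (m + 2 * i))) ≤ H y          ≡⟨ cong (_≤ H y) H-mirror ⟩
      suc (m + i) ≤ H y                        ≈⟨ ≤H-high (s≤s (m≤m+n m i)) ⟩
      2 * suc (m + i) ≤ suc (y + m)            ≈⟨ cancel⇔ (suc m) (ring m i) (sym (+-suc y m)) ⟩
      suc (m + 2 * i) ≤ y                      ∎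
      where
      open import Relation.Binary.Reasoning.Setoid (⇔-setoid 0ℓ)
      N∸hi : N ∸ hi x ≡ suc (suc (m + 2 * i))
      N∸hi = trans (cong₂ _∸_ N≡ hi-x) (m+n∸m≡n e _)
      H-mirror : H (suc (suc (m + 2 * i))) ≡ suc (m + i)
      H-mirror = trans (cong ⌊_/2⌋ (trans (q-high (s≤s (≤-trans (m≤m+n m (2 * i)) (n≤1+n _)))) (ring m i)))
                       (⌊1+2*/2⌋ (suc (m + i)))
        where
        ring : ∀ m i → suc (suc (suc (m + 2 * i)) + m) ≡ suc (2 * suc (m + i))
        ring = solve-∀
      ring : ∀ m i → 2 * suc (m + i) ≡ suc (m + 2 * i) + suc m
      ring = solve-∀

    upper⇔ : ∀ {y} → y < n → H y ≤ H (N ∸ lo x) ⇔ y ≤ suc (suc (suc (suc (m + 2 * i))))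
    upper⇔ {y} y<n = by-e e refl x≤e
      where
      open import Relation.Binary.Reasoning.Setoid (⇔-setoid 0ℓ)
      by-e : ∀ v → e ≡ v → x ≤ v → H y ≤ H (N ∸ lo x) ⇔ y ≤ suc (suc (suc (suc (m + 2 * i))))
      by-e zero e≡0 z≤n =
        both (H-mono y≤N) (≤-trans y≤N (≤-trans (≤-reflexive (trans N≡ (cong (_+ _) e≡0))) (m≤n+m _ 2)))
        where
        y≤N : y ≤ N
        y≤N = ≤-pred y<n
      by-e (suc e') e≡1+e' _ = begin
        H y ≤ H (N ∸ lo x)                              ≡⟨ cong (λ k → H y ≤ H k) N∸lo ⟩
        H y ≤ H (suc (suc (suc (m + 2 * i))))           ≡⟨ cong (H y ≤_) H-mirror ⟩
        H y ≤ suc (suc (m + i))                         ≈⟨ H≤-high (≤-trans (m≤m+n m i) (m≤n+m _ 2)) ⟩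
        y + m ≤ 2 * suc (suc (m + i))                   ≈⟨ cancel⇔ m refl (ring m i) ⟩
        y ≤ suc (suc (suc (suc (m + 2 * i))))           ∎
        where
        m≡′ : m ≡ suc e' + suc (suc (suc (2 * i)))
        m≡′ = trans m≡ (cong (_+ _) e≡1+e')
        lo-x : lo x ≡ e'
        lo-x = lo-of-even {x = x} (trans (q-low e'≤m) (trans (cong (e' +_) m≡′) (trans (ring′ e' i) (cong (2 *_) (sym H-x′)))))
          where
          e'≤m : e' ≤ m
          e'≤m = subst (e' ≤_) (sym m≡′) (≤-trans (n≤1+n e') (m≤m+n _ _))
          H-x′ : H x ≡ suc (suc e' + i)
          H-x′ = trans H-x (cong (λ v → suc (v + i)) e≡1+e')
          ring′ : ∀ e' i → e' + (suc e' + suc (suc (suc (2 * i)))) ≡ 2 * suc (suc e' + i)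
          ring′ = solve-∀
        N∸lo : N ∸ lo x ≡ suc (suc (suc (m + 2 * i)))
        N∸lo = trans (cong₂ _∸_ (trans N≡ (trans (cong (_+ _) e≡1+e') (sym (+-suc e' _)))) lo-x) (m+n∸m≡n e' _)
        H-mirror : H (suc (suc (suc (m + 2 * i)))) ≡ suc (suc (m + i))
        H-mirror = trans (cong ⌊_/2⌋ (trans (q-high (s≤s (≤-trans (m≤m+n m (2 * i)) (m≤n+m _ 2)))) (ring″ m i)))
                         (⌊2*/2⌋ (suc (suc (m + i))))
          where
          ring″ : ∀ m i → suc (suc (suc (suc (m + 2 * i))) + m) ≡ 2 * suc (suc (m + i))
          ring″ = solve-∀
        ring : ∀ m i → 2 * suc (suc (m + i)) ≡ suc (suc (suc (suc (m + 2 * i)))) + m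
        ring = solve-∀

    row⇔ : ∀ {y} → y < n → Z x y ≢ 0ℚ ⇔ (suc (m + 2 * i) ≤ y × y ≤ suc (suc (suc (suc (m + 2 * i)))))
    row⇔ {y} y<n = begin
      Z x y ≢ 0ℚ
        ≈⟨ Z-nonzero⇔ x<n ⟩
      (MirrorBounds x y ⊎ (TwistedBlock x × TwistedBlock y))
        ≈⟨ mk⇔ [ id , ⊥-elim ∘ not-twisted-below {x} Hx<c ∘ proj₁ ]′ inj₁ ⟩
      MirrorBounds x y
        ≈⟨ lower⇔ ×-⇔ upper⇔ y<n ⟩
      (suc (m + 2 * i) ≤ y × y ≤ suc (suc (suc (suc (m + 2 * i))))) ∎
      where
      open import Relation.Binary.Reasoning.Setoid (⇔-setoid 0ℓ)
      x<n : x < n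
      x<n = ≤-<-trans x≤e (≤-<-trans (subst (e ≤_) (sym m≡) (m≤m+n e _)) m<n)
      Hx<c : suc (H x) ≤ c
      Hx<c = subst₂ _≤_ (cong suc (sym H-x)) (sym c≡) (ring e i)
        where
        ring : ∀ e i → suc (suc (e + i)) ≤ e + suc (suc (2 * i))
        ring e i = subst (suc (suc (e + i)) ≤_) (eq e i) (m≤m+n _ i)
          where
          eq : ∀ e i → suc (suc (e + i)) + i ≡ e + suc (suc (2 * i))
          eq = solve-∀

  row-below : ∀ {x y} → suc (suc x) ≤ c → y < n → Z x y ≢ 0ℚ ⇔ Sharp x y
  row-below {x} {y} x+2≤c y<n = ⇔-trans (by-parity (parity s)) (⇔-sym sharp)
    where
    s i : ℕ
    s = c ∸ suc (suc x)
    i = ⌊ s /2⌋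
    x≤m : x ≤ m
    x≤m = ≤-trans (≤-trans (n≤1+n x) (n≤1+n (suc x))) (≤-trans x+2≤c (n≤1+n c))
    m≡ : m ≡ suc x + suc (suc s)
    m≡ = cong suc (trans (sym (m+[n∸m]≡n x+2≤c)) (sym (trans (+-suc x (suc s)) (cong suc (+-suc x s)))))
    Bounds : ℕ → Set
    Bounds y = suc (m + 2 * i) ≤ y × y ≤ suc (suc (suc (suc (m + 2 * i))))
    sharp : Sharp x y ⇔ Bounds y
    sharp = ⇔-trans (sharp-below s m≡) (cancel⇔ 1 (ring₂ m i) (+-comm 1 y) ×-⇔ cancel⇔ 1 (+-comm 1 y) (ring₃ m i))
      where
      ring₂ : ∀ m i → 2 * suc i + m ≡ suc (m + 2 * i) + 1
      ring₂ = solve-∀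
      ring₃ : ∀ m i → 2 * suc i + 3 + m ≡ suc (suc (suc (suc (m + 2 * i)))) + 1
      ring₃ = solve-∀
    by-parity : s ≡ 2 * i ⊎ s ≡ suc (2 * i) → Z x y ≢ 0ℚ ⇔ Bounds y
    by-parity (inj₁ s≡2i) = BelowBlock.row⇔ i x m≡x x ≤-refl H-x y<n
      where
      m≡x : m ≡ x + suc (suc (suc (2 * i)))
      m≡x = trans m≡ (trans (cong (λ s → suc x + suc (suc s)) s≡2i) (sym (+-suc x _)))
      H-x : H x ≡ suc (x + i)
      H-x = trans (cong ⌊_/2⌋ (trans (q-low x≤m) (trans (cong (x +_) m≡x) (ring x i)))) (⌊1+2*/2⌋ (suc (x + i)))
        where
        ring : ∀ x i → x + (x + suc (suc (suc (2 * i)))) ≡ suc (2 * suc (x + i))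
        ring = solve-∀
    by-parity (inj₂ s≡2i+1) = BelowBlock.row⇔ i (suc x) m≡x x (n≤1+n x) H-x y<n
      where
      m≡x : m ≡ suc x + suc (suc (suc (2 * i)))
      m≡x = trans m≡ (cong (λ s → suc x + suc (suc s)) s≡2i+1)
      H-x : H x ≡ suc (suc x + i)
      H-x = trans (cong ⌊_/2⌋ (trans (q-low x≤m) (trans (cong (x +_) m≡x) (ring x i)))) (⌊2*/2⌋ (suc (suc x + i)))
        where
        ring : ∀ x i → x + (suc x + suc (suc (suc (2 * i)))) ≡ 2 * suc (suc x + i)
        ring = solve-∀

  lower-c⇔ : ∀ {y} → c ≤ H y ⇔ m ≤ suc y + 1
  lower-c⇔ {y} = ⇔-trans (≤H-low (n≤1+n c))
                         (⇔-trans (cancel⇔ c (cong (c +_) (+-identityʳ c)) (+-suc y c)) (⇔-sym (cancel⇔ 1 (+-comm 1 c) refl)))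

  row-twisted : ∀ {x y} → x < n → H x ≡ c → Z x y ≢ 0ℚ ⇔ (m ≤ suc y + 1 × suc y ≤ 3 + m)
  row-twisted {x} {y} x<n Hx≡c = begin
    Z x y ≢ 0ℚ                                                     ≈⟨ Z-nonzero⇔ x<n ⟩
    (MirrorBounds x y ⊎ (TwistedBlock x × TwistedBlock y))         ≈⟨ ≡⇒⇔ mirror ⊎-⇔ mk⇔ proj₂ (twisted-x ,_) ⟩
    ((m ≤ H y × H y ≤ suc m) ⊎ (c ≤ H y × H y ≤ m))                ≈⟨ interval-∪ (n≤1+n c) (n≤1+n m) (n≤1+n m) ⟩
    (c ≤ H y × H y ≤ suc m)                                        ≈⟨ lower-c⇔ ×-⇔ upper ⟩
    (m ≤ suc y + 1 × suc y ≤ 3 + m)                                ∎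
    where
    open import Relation.Binary.Reasoning.Setoid (⇔-setoid 0ℓ)
    twisted-x : TwistedBlock x
    twisted-x = subst (λ h → c ≤ h × h ≤ m) (sym Hx≡c) (≤-refl , n≤1+n c)
    N∸c : N ∸ c ≡ m
    N∸c = trans (cong (_∸ c) N≡c+m) (m+n∸m≡n c m)
    N∸pred-c : N ∸ pred c ≡ suc m
    N∸pred-c = trans (cong (_∸ pred c) (trans N≡c+m (trans (cong (_+ m) (sym 1+pred-c)) (sym (+-suc (pred c) m)))))
                     (m+n∸m≡n (pred c) (suc m))
    mirror : MirrorBounds x y ≡ (m ≤ H y × H y ≤ suc m)
    mirror = trans (cong₂ (λ s e → H (N ∸ s) ≤ H y × H y ≤ H (N ∸ e)) hi-x lo-x)
                   (cong₂ (λ a b → a ≤ H y × H y ≤ b) (trans (cong H N∸c) H-m) (trans (cong H N∸pred-c) H-1+m))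
      where
      Hx≡Hc : H x ≡ H c
      Hx≡Hc = trans Hx≡c (sym H-c)
      hi-x : hi x ≡ c
      hi-x = trans (hi-cong {x} {c} x<n c<n Hx≡Hc) hi-c
      lo-x : lo x ≡ pred c
      lo-x = trans (lo-cong {x} {c} Hx≡Hc) lo-c
    upper : H y ≤ suc m ⇔ suc y ≤ 3 + m
    upper = ⇔-trans (H≤-high (n≤1+n m)) (⇔-trans (cancel⇔ m refl (ring m)) (mk⇔ s≤s ≤-pred))
      where
      ring : ∀ m → 2 * suc m ≡ suc (suc m) + m
      ring = solve-∀

  row-m : ∀ {y} → Z m y ≢ 0ℚ ⇔ (m ≤ suc y + 1 × suc y ≤ 1 + m)
  row-m {y} = begin
    Z m y ≢ 0ℚ
      ≈⟨ Z-nonzero⇔ m<n ⟩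
    (MirrorBounds m y ⊎ (TwistedBlock m × TwistedBlock y))
      ≈⟨ ≡⇒⇔ mirror ⊎-⇔ mk⇔ proj₂ (twisted-m ,_) ⟩
    ((c ≤ H y × H y ≤ c) ⊎ (c ≤ H y × H y ≤ m))
      ≈⟨ mk⇔ [ (λ (c≤ , ≤c) → c≤ , ≤-trans ≤c (n≤1+n c)) , id ]′ inj₂ ⟩
    (c ≤ H y × H y ≤ m)
      ≈⟨ lower-c⇔ ×-⇔ upper ⟩
    (m ≤ suc y + 1 × suc y ≤ 1 + m) ∎
    where
    open import Relation.Binary.Reasoning.Setoid (⇔-setoid 0ℓ)
    twisted-m : TwistedBlock m
    twisted-m = subst (λ h → c ≤ h × h ≤ m) (sym H-m) (n≤1+n c , ≤-refl)
    N∸m : N ∸ m ≡ c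
    N∸m = trans (cong (_∸ m) N≡c+m) (m+n∸n≡m c m)
    mirror : MirrorBounds m y ≡ (c ≤ H y × H y ≤ c)
    mirror = trans (cong₂ (λ s e → H (N ∸ s) ≤ H y × H y ≤ H (N ∸ e)) hi-m lo-m)
                   (cong (λ a → a ≤ H y × H y ≤ a) (trans (cong H N∸m) H-c))
    upper : H y ≤ m ⇔ suc y ≤ 1 + m
    upper = ⇔-trans (H≤-high ≤-refl) (⇔-trans (cancel⇔ m refl 2m≡m+m) (mk⇔ s≤s ≤-pred))

  sharp-twisted : ∀ {x y} → offset m x ≡ ℤ.+ 0 ⊎ offset m x ≡ ℤ.-[1+ 0 ] →
                  Sharp x y ⇔ (m ≤ suc y + 1 × suc y ≤ 3 + m)
  sharp-twisted {x} {y} (inj₁ r≡0) = ⇔-trans (≡⇒⇔ (cong (λ r → sharpEntry r (offset m y) ≡ true) r≡0)) (column-+ 1 3)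
  sharp-twisted {x} {y} (inj₂ r≡-1) = ⇔-trans (≡⇒⇔ (cong (λ r → sharpEntry r (offset m y) ≡ true) r≡-1)) (column-+ 1 3)

  sharp-m : ∀ {y} → Sharp m y ⇔ (m ≤ suc y + 1 × suc y ≤ 1 + m)
  sharp-m {y} = ⇔-trans (≡⇒⇔ (cong (λ r → sharpEntry r (offset m y) ≡ true) offset-m)) (column-+ 1 1)
    where
    offset-m : offset m m ≡ ℤ.+ 1
    offset-m = trans (cong (λ k → ℤ.+ k ℤ.- ℤ.+ m) (+-comm 1 m)) (difference-+ m 1)

  offset-c : offset m c ≡ ℤ.+ 0
  offset-c = trans (cong (λ k → ℤ.+ k ℤ.- ℤ.+ m) (sym (+-identityʳ m))) (difference-+ m 0)

  offset-pred-c : offset m (pred c) ≡ ℤ.-[1+ 0 ]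
  offset-pred-c = trans (cong₂ (λ a b → ℤ.+ a ℤ.- ℤ.+ b) 1+pred-c (+-comm 1 c)) (difference-- c 0)

  Z-pattern : ∀ {x y} → x < n → y < n → Z x y ≢ 0ℚ ⇔ Sharp x y
  Z-pattern {x} {y} x<n y<n with <-cmp x m
  ... | tri> _ _ m<x = subst (λ x → Z x y ≢ 0ℚ ⇔ Sharp x y) x≡ (AboveRow.row⇔ d (subst (_< n) (sym x≡) x<n))
    where
    d : ℕ
    d = x ∸ suc m
    x≡ : suc m + d ≡ x
    x≡ = m+[n∸m]≡n m<x
  ... | tri≈ _ refl _ = ⇔-trans row-m (⇔-sym sharp-m)
  ... | tri< x<m _ _ with <-cmp x c
  ...   | tri≈ _ refl _ = ⇔-trans (row-twisted c<n H-c) (⇔-sym (sharp-twisted (inj₁ offset-c)))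
  ...   | tri> _ _ c<x = ⊥-elim (1+n≰n (≤-trans x<m c<x))
  ...   | tri< x<c _ _ with m≤n⇒m<n∨m≡n x<c
  ...     | inj₁ x+2≤c = row-below x+2≤c y<n
  ...     | inj₂ 1+x≡c = subst (λ x → Z x y ≢ 0ℚ ⇔ Sharp x y) x≡pred-c
                           (⇔-trans (row-twisted pred-c<n H-pred-c) (⇔-sym (sharp-twisted (inj₂ offset-pred-c))))
    where
    x≡pred-c : pred c ≡ x
    x≡pred-c = cong pred (sym 1+x≡c)
    pred-c<n : pred c < n
    pred-c<n = ≤-<-trans pred[n]≤n c<n
    H-pred-c : H (pred c) ≡ c
    H-pred-c = trans (cong H (sym lo-c)) (trans (H-lo c) H-c)

  evenWitness : ∃ λ (Z′ : Matrix n) → IsSymmetric Z′ × IsOrthogonal Z′ × HasZeroPattern Z′ (Λ# m)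
  evenWitness = toMatrix n Z , toMatrix-symmetric n {Z} Z-symmetric ,
                toMatrix-orthogonal n {Z} (symmetric-involution⇒orthogonal n Z-symmetric Z-involutive) ,
                λ i j → Z-pattern (toℕ<n i) (toℕ<n j)

mainTheorem9 :
    (∀ (m : ℕ) → 1 ≤ m →
      ∃ λ (Y : Matrix (suc (2 * m))) →
        IsSymmetric Y × IsOrthogonal Y × HasZeroPattern Y (Λ (suc (2 * m))))
    × (∀ (m : ℕ) → 2 ≤ m →
      ∃ λ (Z : Matrix (2 * m)) →
        IsSymmetric Z × IsOrthogonal Z × HasZeroPattern Z (Λ# m))
mainTheorem9 = (λ m _ → OddCase.oddWitness m) , even
  where
  even : ∀ m → 2 ≤ m → ∃ λ (Z : Matrix (2 * m)) → IsSymmetric Z × IsOrthogonal Z × HasZeroPattern Z (Λ# m)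
  even (suc (suc c)) _         = EvenCase.evenWitness (suc c) (s≤s z≤n)
  even (suc zero)    (s≤s ())
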